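{- Let $\mathfrak g$ be of type $B_n$ or $C_n$ and fix a row index $j\in\{1,\dots,n\}$. Let $T\in\mathcal T(\infty)$ be such that all unshaded boxes of $T$ lie in row $j$. If the leftmost `(' in the $n$-signature of $T$ comes from a box of row $j$, then $f_n^{\mathrm{Kp}}\Psi(T)=\Psi(f_n^{\mathcal T}T)$.
   Context: Roots. Type $B_n$: $\beta_{i,k}=\alpha_i+\cdots+\alpha_k$ ($1\le i\le k\le n$), $\gamma_{i,k}=\alpha_i+\cdots+\alpha_{k-1}+2\alpha_k+\cdots+2\alpha_n$ ($1\le i<k\le n$). Type $C_n$: $\beta_{i,k}=\alpha_i+\cdots+\alpha_k$ ($1\le i\le k<n$), $\gamma_{i,k}=\alpha_i+\cdots+\alpha_{n-1}+\alpha_n+\alpha_{n-1}+\cdots+\alpha_k$ ($1\le i\le k\le n$); these are the positive roots. Marginally large tableaux $\mathcal T(\infty)$: alphabets $J=\{1\prec\cdots\prec n\prec0\prec\overline n\prec\cdots\prec\overline1\}$ (type $B_n$) and $J=\{1\prec\cdots\prec n\prec\overline n\prec\cdots\prec\overline1\}$ (type $C_n$); semistandard tableaux with $n$ rows, entries in $J$, such that the number of $i$'s in row $i$ is one more than the number of boxes in row $i+1$, rows weakly increase, entries of row $i$ are $\preceq\overline\imath$, and (type $B_n$) $0$ occurs at most once per row. The boxes $i$ in row $i$ are shaded. The $n$-signature: read $T$ row by row, each row right to left, rows top to bottom; in type $B_n$ replace $n\mapsto(($, $0\mapsto)($, $\overline n\mapsto))$; in type $C_n$ replace $n\mapsto($,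 $\overline n\mapsto)$; other letters by nothing; successively cancel adjacent $()$ pairs. $f_n^{\mathcal T}T$: replace the entry $\ell$ of the box giving the leftmost remaining `(' by its successor in $J$; if that box is in row $n$ and $\ell=n$, also insert a column $1,2,\dots,n$ directly to its left. Kostant partitions $\mathrm{Kp}(\infty)$: formal sums $\sum_{\beta\in\Phi^+}c_\beta(\beta)$, $c_\beta\in\mathbb Z_{\ge0}$. $S_n(\boldsymbol\alpha)$ (brackets labelled by roots): type $B_n$: concatenation over $k=1,\dots,n-1$ of $)^{c_{\beta_{k,n}}}(^{2c_{\beta_{k,n-1}}})^{2c_{\gamma_{k,n}}}(^{c_{\beta_{k,n}}}$ (labels $\beta_{k,n},\beta_{k,n-1},\gamma_{k,n},\beta_{k,n}$), followed by $)^{c_{\beta_{n,n}}}$; type $C_n$: concatenation over $k=1,\dots,n-1$ of $)^{c_{\gamma_{k,k}}}(^{c_{\beta_{k,n-1}}})^{c_{\gamma_{k,n}}}(^{c_{\gamma_{k,k}}}$ (labels $\gamma_{k,k},\beta_{k,n-1},\gamma_{k,n},\gamma_{k,k}$), followed by $)^{c_{\gamma_{n,n}}}$. Cancel $()$ pairs; let $\gamma$ label the leftmost remaining `('. Type $B_n$: $f_n^{\mathrm{Kp}}\boldsymbol\alpha=\boldsymbol\alpha-(\gamma)+(\gamma+\alpha_n)$, or $\boldsymbol\alpha+(\alpha_n)$ if no `(' remains. Type $C_n$, $k\in\{1,\dots,n-1\}$: if $\gamma=\beta_{k,n-1}$ and $c_{\gamma_{k,n}}=c_{\beta_{k,n-1}}-1$,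 $f_n^{\mathrm{Kp}}\boldsymbol\alpha=\boldsymbol\alpha-(\gamma)+(\gamma_{k,n})$; if $\gamma=\beta_{k,n-1}$ and $c_{\gamma_{k,n}}<c_{\beta_{k,n-1}}-1$, $f_n^{\mathrm{Kp}}\boldsymbol\alpha=\boldsymbol\alpha-2(\gamma)+(\gamma_{k,k})$; if $\gamma=\gamma_{k,k}$, $f_n^{\mathrm{Kp}}\boldsymbol\alpha=\boldsymbol\alpha-(\gamma)+2(\gamma_{k,n})$; if no `(' remains, $f_n^{\mathrm{Kp}}\boldsymbol\alpha=\boldsymbol\alpha+(\gamma_{n,n})$. The map $\Psi$: $\Psi(T)=\sum_j\Psi(R_j)$ over rows $R_j$, where $\Psi(R_j)$ sums contributions of the unshaded boxes of row $j$, boxes $k,\overline k$ of row $j$ being grouped into $\min(\#k,\#\overline k)$ pairs $(k,\overline k)$, the rest unpaired: type $B_n$: pair $(n,\overline n)\mapsto2(\beta_{j,n})$, box $0\mapsto(\beta_{j,n})$, if $j=n$ box $\overline n\mapsto2(\beta_{n,n})$; type $C_n$: pair $(n,\overline n)\mapsto(\gamma_{j,j})$, if $j=n$ box $\overline n\mapsto(\gamma_{n,n})$; remaining boxes: $\overline j\mapsto(\beta_{j,j})+(\gamma_{j,j+1})$; pair $(k,\overline k)$ with $j<k<n$ $\mapsto(\beta_{j,k})+(\gamma_{j,k+1})$; unpaired $k\in\{j+1,\dots,n\}\mapsto(\beta_{j,k-1})$; unpaired $\overline k$, $k\in\{j+1,\dots,n\}$, $\mapsto(\gamma_{j,k})$.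 -}

module Defs where

open import Data.Nat using (ℕ; zero; suc; _+_; _*_; _∸_; _≤_; _<_; _⊓_; _≡ᵇ_; _<ᵇ_; pred)
open import Data.Bool using (Bool; true; false; if_then_else_; _∧_)
open import Data.List using (List; []; _∷_; _++_; map; concat; concatMap; length; reverse; zip; upTo; replicate; take; drop; foldr)
open import Data.List.Relation.Unary.All using (All)
open import Data.Product using (_×_; _,_; Σ)
open import Data.Maybe using (Maybe; just; nothing)
open import Relation.Binary.PropositionalEquality using (_≡_)

data Ty : Set where
  B C : Ty

-- Generic list helpers (indices of positions are 0-based; row indices
-- are 1-based as in the paper)

nthD : {A : Set} → A → List A → ℕ → A
nthD d []       _       = d
nthD d (x ∷ xs) zero    = x
nthD d (x ∷ xs) (suc p) = nthD d xs p

modifyAt : {A : Set} → List A → ℕ → (A → A) → List A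
modifyAt []       _       f = []
modifyAt (x ∷ xs) zero    f = f x ∷ xs
modifyAt (x ∷ xs) (suc p) f = x ∷ modifyAt xs p f

insertAt : {A : Set} → List A → ℕ → A → List A
insertAt xs p x = take p xs ++ (x ∷ drop p xs)

indexed : {A : Set} → List A → List (ℕ × A)
indexed xs = zip (upTo (length xs)) xs

range : ℕ → ℕ → List ℕ
range a b = map (a +_) (upTo (b ∸ a))

lastM : {A : Set} → List A → Maybe A
lastM []           = nothing
lastM (x ∷ [])     = just x
lastM (x ∷ y ∷ xs) = lastM (y ∷ xs)

-- Brackets and cancellation of adjacent () pairs.
-- leftmostOpen w  = label of the leftmost '(' remaining after successively
-- cancelling adjacent "()" pairs (computed with a stack; nothing if none).

data Br : Set where
  op cl : Br

leftmostOpenGo : {A : Set} → List (Br × A) → List A → Maybe A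
leftmostOpenGo []              stack       = lastM stack
leftmostOpenGo ((op , a) ∷ w)  stack       = leftmostOpenGo w (a ∷ stack)
leftmostOpenGo ((cl , a) ∷ w)  []          = leftmostOpenGo w []
leftmostOpenGo ((cl , a) ∷ w)  (_ ∷ stack) = leftmostOpenGo w stack

leftmostOpen : {A : Set} → List (Br × A) → Maybe A
leftmostOpen w = leftmostOpenGo w []

-- The alphabet J.  num i = i, zer = 0 (type B only), bar i = \bar i.

data Letter : Set where
  num : ℕ → Letter
  zer : Letter
  bar : ℕ → Letter

ValidLetter : Ty → ℕ → Letter → Set
ValidLetter ty n (num i) = (1 ≤ i) × (i ≤ n)
ValidLetter ty n zer     = ty ≡ B
ValidLetter ty n (bar i) = (1 ≤ i) × (i ≤ n)

-- position in the total order of J: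
-- 1 < ... < n < 0 < \bar n < ... < \bar 1
rank : ℕ → Letter → ℕ
rank n (num i) = i
rank n zer     = suc n
rank n (bar i) = (2 * n + 2) ∸ i

eqL : Letter → Letter → Bool
eqL (num i) (num k) = i ≡ᵇ k
eqL zer     zer     = true
eqL (bar i) (bar k) = i ≡ᵇ k
eqL _       _       = false

cnt : Letter → List Letter → ℕ
cnt x []       = 0
cnt x (y ∷ ys) = if eqL x y then suc (cnt x ys) else cnt x ys

-- successor in J (only ever applied to n and 0)
succJ : Ty → ℕ → Letter → Letter
succJ B n (num i) = if i <ᵇ n then num (suc i) else zer
succJ C n (num i) = if i <ᵇ n then num (suc i) else bar n
succJ ty n zer    = bar n
succJ ty n (bar i) = bar (pred i)

-- Tableaux: list of rows (row 1 first), each row a list of letters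
-- read left to right.

Tab : Set
Tab = List (List Letter)

-- row i (1-based); empty if out of range
rowAt : Tab → ℕ → List Letter
rowAt T zero    = []
rowAt T (suc i) = nthD [] T i

entry : Tab → ℕ → ℕ → Letter
entry T i p = nthD zer (rowAt T i) p

record IsTinf (ty : Ty) (n : ℕ) (T : Tab) : Set where
  field
    nRows     : length T ≡ n
    letters   : ∀ i → 1 ≤ i → i ≤ n → All (ValidLetter ty n) (rowAt T i)
    rowsWeak  : ∀ i p → 1 ≤ i → i ≤ n → suc p < length (rowAt T i) →
                rank n (entry T i p) ≤ rank n (entry T i (suc p))
    colStrict : ∀ i p → 1 ≤ i → i < n → p < length (rowAt T (suc i)) →
                (p < length (rowAt T i)) ×
                (rank n (entry T i p) < rank n (entry T (suc i) p))
    marginal  : ∀ i → 1 ≤ i → i ≤ n →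
                cnt (num i) (rowAt T i) ≡ suc (length (rowAt T (suc i)))
    bounded   : ∀ i → 1 ≤ i → i ≤ n →
                All (λ x → rank n x ≤ rank n (bar i)) (rowAt T i)
    zeroOnce  : ty ≡ B → ∀ i → 1 ≤ i → i ≤ n → cnt zer (rowAt T i) ≤ 1

-- all unshaded boxes lie in row j: every row i ≠ j consists of shaded i's
UnshadedOnlyInRow : ℕ → ℕ → Tab → Set
UnshadedOnlyInRow n j T =
  ∀ i → 1 ≤ i → i ≤ n → (i ≡ j → Data.Empty.⊥) → All (λ x → x ≡ num i) (rowAt T i)
  where import Data.Empty

-- n-signature of a tableau; brackets labelled by the box (row, column)

sigLetter : Ty → ℕ → Letter → List Br
sigLetter B n (num i) = if i ≡ᵇ n then op ∷ op ∷ [] else []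
sigLetter B n zer     = cl ∷ op ∷ []
sigLetter B n (bar i) = if i ≡ᵇ n then cl ∷ cl ∷ [] else []
sigLetter C n (num i) = if i ≡ᵇ n then op ∷ [] else []
sigLetter C n zer     = []
sigLetter C n (bar i) = if i ≡ᵇ n then cl ∷ [] else []

rowSig : Ty → ℕ → ℕ → List Letter → List (Br × (ℕ × ℕ))
rowSig ty n i r =
  concatMap (λ { (p , x) → map (λ b → (b , (i , p))) (sigLetter ty n x) })
            (reverse (indexed r))

-- rows 1..n, each read right to left, top to bottom
signatureT : Ty → ℕ → Tab → List (Br × (ℕ × ℕ))
signatureT ty n T = concatMap (λ i → rowSig ty n i (rowAt T i)) (range 1 (suc n))

leftmostOpenT : Ty → ℕ → Tab → Maybe (ℕ × ℕ)
leftmostOpenT ty n T = leftmostOpen (signatureT ty n T)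

modifyRow : Tab → ℕ → (List Letter → List Letter) → Tab
modifyRow T zero    f = T
modifyRow T (suc i) f = modifyAt T i f

insertColumn : Tab → ℕ → Tab
insertColumn T p = map (λ { (k , r) → insertAt r p (num (suc k)) }) (indexed T)

fT : Ty → ℕ → Tab → Tab
fT ty n T with leftmostOpenT ty n T
... | nothing      = T
... | just (i , p) =
  let T₁ = modifyRow T i (λ r → modifyAt r p (succJ ty n)) in
  if (i ≡ᵇ n) ∧ eqL (entry T i p) (num n) then insertColumn T₁ p else T₁

data Root : Set where
  β γ : ℕ → ℕ → Root

eqR : Root → Root → Bool
eqR (β i k) (β i' k') = (i ≡ᵇ i') ∧ (k ≡ᵇ k')
eqR (γ i k) (γ i' k') = (i ≡ᵇ i') ∧ (k ≡ᵇ k')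
eqR _       _         = false

Kp : Set
Kp = Root → ℕ

zeroK : Kp
zeroK _ = 0

one : Root → Kp
one r r' = if eqR r r' then 1 else 0

infixl 6 _⊕_ _⊖_

_⊕_ : Kp → Kp → Kp
(a ⊕ b) r = a r + b r

_⊖_ : Kp → Kp → Kp
(a ⊖ b) r = a r ∸ b r

scale : ℕ → Kp → Kp
scale m a r = m * a r

sumK : List Kp → Kp
sumK = foldr _⊕_ zeroK

-- γ + α_n for the labels β_{k,n-1}, β_{k,n} of '(' in type B:
-- β_{k,n-1} + α_n = β_{k,n},  β_{k,n} + α_n = γ_{k,n}
plusAlphaN : ℕ → Root → Root
plusAlphaN n (β i k) = if k ≡ᵇ n then γ i n else β i (suc k)
plusAlphaN n (γ i k) = γ i k

rep : ℕ → Br → Root → List (Br × Root)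
rep m b r = replicate m (b , r)

SnWord : Ty → ℕ → Kp → List (Br × Root)
SnWord B n c =
  concatMap (λ k → rep (c (β k n)) cl (β k n)
                ++ rep (2 * c (β k (n ∸ 1))) op (β k (n ∸ 1))
                ++ rep (2 * c (γ k n)) cl (γ k n)
                ++ rep (c (β k n)) op (β k n))
            (range 1 n)
  ++ rep (c (β n n)) cl (β n n)
SnWord C n c =
  concatMap (λ k → rep (c (γ k k)) cl (γ k k)
                ++ rep (c (β k (n ∸ 1))) op (β k (n ∸ 1))
                ++ rep (c (γ k n)) cl (γ k n)
                ++ rep (c (γ k k)) op (γ k k))
            (range 1 n)
  ++ rep (c (γ n n)) cl (γ n n)

fKp : Ty → ℕ → Kp → Kp
fKp B n c with leftmostOpen (SnWord B n c)
... | nothing = c ⊕ one (β n n)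
... | just g  = (c ⊖ one g) ⊕ one (plusAlphaN n g)
fKp C n c with leftmostOpen (SnWord C n c)
... | nothing      = c ⊕ one (γ n n)
... | just (β k l) =
  if c (γ k n) ≡ᵇ c (β k l) ∸ 1
  then (c ⊖ one (β k l)) ⊕ one (γ k n)
  else (if c (γ k n) <ᵇ c (β k l) ∸ 1
        then (c ⊖ scale 2 (one (β k l))) ⊕ one (γ k k)
        else c)
... | just (γ k l) = (c ⊖ one (γ k l)) ⊕ scale 2 (one (γ k n))

ΨrowLow : Ty → ℕ → ℕ → List Letter → Kp
ΨrowLow ty n j r =
  pairN ty ⊕ zeroBox ty
  ⊕ scale (b j) (one (β j j) ⊕ one (γ j (suc j)))
  ⊕ sumK (map (λ k → scale (m k) (one (β j k) ⊕ one (γ j (suc k)))) (range (suc j) n))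
  ⊕ sumK (map (λ k → scale (a k ∸ m k) (one (β j (k ∸ 1)))) (range (suc j) (suc n)))
  ⊕ sumK (map (λ k → scale (b k ∸ m k) (one (γ j k))) (range (suc j) (suc n)))
  where
    a b m : ℕ → ℕ
    a k = cnt (num k) r
    b k = cnt (bar k) r
    m k = a k ⊓ b k
    pairN : Ty → Kp
    pairN B = scale (2 * m n) (one (β j n))
    pairN C = scale (m n) (one (γ j j))
    zeroBox : Ty → Kp
    zeroBox B = scale (cnt zer r) (one (β j n))
    zeroBox C = zeroK

ΨrowTop : Ty → ℕ → List Letter → Kp
ΨrowTop B n r = scale (cnt zer r) (one (β n n)) ⊕ scale (2 * cnt (bar n) r) (one (β n n))
ΨrowTop C n r = scale (cnt (bar n) r) (one (γ n n))

Ψrow : Ty → ℕ → ℕ → List Letter → Kp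
Ψrow ty n j r = if j <ᵇ n then ΨrowLow ty n j r else ΨrowTop ty n r

Ψ : Ty → ℕ → Tab → Kp
Ψ ty n T = sumK (map (λ j → Ψrow ty n j (rowAt T j)) (range 1 (suc n)))

-- Since every row of T other than row j is shaded, Ψ(T) is the contribution of row j alone, a
-- Kostant partition supported on the roots β_{j,k}, γ_{j,k}; so only the j-th block of S_n(Ψ T)
-- survives. In a row j < n the boxes n, 0, n̄ contribute at three roots only, and the other boxes
-- contribute equally at the two of them that label brackets of opposite kinds in S_n; hence the
-- leftmost '(' of S_n is decided by whether n or n̄ is in surplus. The box of the leftmost '(' of
-- the signature holds n or 0, and f_n replaces it by its successor; the resulting change of the
-- numbers of n, 0 and n̄ moves weight between the three roots exactly as f_n does on Kostant
-- partitions. In the top row nothing stays open in S_n, both sides gain one β_{n,n} (resp.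
-- γ_{n,n}), and the column inserted by f_n is invisible to Ψ.

module Submission where

open import Defs
open import Level using (0ℓ)
open import Algebra.Bundles using (Monoid)
open import Data.Nat
  using (ℕ; zero; suc; _+_; _*_; _∸_; _≤_; _<_; _⊓_; _≡ᵇ_; _<ᵇ_; z≤n; s≤s; _≤?_; _<?_)
open import Data.Nat.Properties
open import Data.Nat.Tactic.RingSolver using (solve-∀)
open import Data.Bool using (true; false; if_then_else_; _∧_; T)
open import Data.Bool.Properties using (T-≡; T-∧)
open import Data.List
  using ( List; []; _∷_; _++_; _∷ʳ_; map; concatMap; length; reverse; zip; upTo; applyUpTo
        ; replicate; take; drop; foldr)
open import Data.Nat.ListAction using (sum)
open import Data.Nat.ListAction.Properties using (sum-++)
open import Data.List.Properties using (++-identityʳ; map-++; upTo-∷ʳ; take++drop≡id; map-cong-local; ++-monoid)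
open import Data.List.Membership.Propositional using (_∈_; find)
open import Data.List.Membership.Propositional.Properties
  using (∈-map⁺; ∈-map⁻; ∈-upTo⁺; ∈-upTo⁻; ∈-concat⁻)
open import Data.List.Relation.Unary.All as All using (All; []; _∷_)
open import Data.List.Relation.Unary.Any using (here; there)
import Data.List.Relation.Unary.Any.Properties as Any
open import Data.List.Relation.Unary.Unique.Propositional using (Unique; []; _∷_)
import Data.List.Relation.Unary.Unique.Propositional.Properties as Unique
open import Data.Product using (_×_; _,_; proj₁; proj₂; ∃; uncurry)
open import Data.Sum using (_⊎_; inj₁; inj₂)
open import Data.Maybe using (just; nothing)
open import Function using (_∘_; id; Equivalence)
open import Function.Definitions using (Injective)
open import Relation.Binary.Definitions using (DecidableEquality; tri<; tri≈; tri>)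
open import Relation.Binary.PropositionalEquality
open import Relation.Nullary using (¬_; yes; no; contradiction)
open import Relation.Nullary.Decidable using (map′; T?)

n≡0⇒m*n≡0 : ∀ {m n} → n ≡ 0 → m * n ≡ 0
n≡0⇒m*n≡0 {m} refl = *-zeroʳ m

≡ᵇ-refl : ∀ m → (m ≡ᵇ m) ≡ true
≡ᵇ-refl m = Equivalence.to T-≡ (≡⇒≡ᵇ m m refl)

≢⇒≡ᵇ-false : ∀ {m n} → m ≢ n → (m ≡ᵇ n) ≡ false
≢⇒≡ᵇ-false {m} {n} m≢n with m ≡ᵇ n in eq
... | true  = contradiction (≡ᵇ⇒≡ m n (Equivalence.from T-≡ eq)) m≢n
... | false = refl

<⇒<ᵇ-true : ∀ {m n} → m < n → (m <ᵇ n) ≡ true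
<⇒<ᵇ-true {m} {n} m<n = Equivalence.to T-≡ (<⇒<ᵇ m<n)

≮⇒<ᵇ-false : ∀ {m n} → ¬ (m < n) → (m <ᵇ n) ≡ false
≮⇒<ᵇ-false {m} {n} m≮n with m <ᵇ n in eq
... | true  = contradiction (<ᵇ⇒< m n (Equivalence.from T-≡ eq)) m≮n
... | false = refl

eqR-sound : ∀ R S → T (eqR R S) → R ≡ S
eqR-sound (β i k) (β i′ k′) t with Equivalence.to T-∧ t
... | ti , tk = cong₂ β (≡ᵇ⇒≡ i i′ ti) (≡ᵇ⇒≡ k k′ tk)
eqR-sound (γ i k) (γ i′ k′) t with Equivalence.to T-∧ t
... | ti , tk = cong₂ γ (≡ᵇ⇒≡ i i′ ti) (≡ᵇ⇒≡ k k′ tk)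

eqR-refl : ∀ R → T (eqR R R)
eqR-refl (β i k) = Equivalence.from T-∧ (≡⇒≡ᵇ i i refl , ≡⇒≡ᵇ k k refl)
eqR-refl (γ i k) = Equivalence.from T-∧ (≡⇒≡ᵇ i i refl , ≡⇒≡ᵇ k k refl)

_≟ᴿ_ : DecidableEquality Root
R ≟ᴿ S = map′ (eqR-sound R S) (λ { refl → eqR-refl R }) (T? (eqR R S))

one-same : ∀ R → one R R ≡ 1
one-same R rewrite Equivalence.to T-≡ (eqR-refl R) = refl

one-≢ : ∀ R S → R ≢ S → one R S ≡ 0
one-≢ R S R≢S with eqR R S in eq
... | true  = contradiction (eqR-sound R S (Equivalence.from T-≡ eq)) R≢S
... | false = refl

rowOf : Root → ℕ
rowOf (β i _) = i
rowOf (γ i _) = i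

one-otherRow : ∀ {R S} → rowOf R ≢ rowOf S → one R S ≡ 0
one-otherRow {R} {S} ne = one-≢ R S (ne ∘ cong rowOf)

SupportedOnRow : ℕ → Kp → Set
SupportedOnRow j c = ∀ ρ → rowOf ρ ≢ j → c ρ ≡ 0

module _ (M : Monoid 0ℓ 0ℓ) where
  open Monoid M renaming (refl to ≈-refl; trans to ≈-trans; sym to ≈-sym)

  fold-ε : ∀ {A : Set} (f : A → Carrier) xs → (∀ x → x ∈ xs → f x ≈ ε) →
           foldr _∙_ ε (map f xs) ≈ ε
  fold-ε f []       _   = ≈-refl
  fold-ε f (x ∷ xs) f≈ε =
    ≈-trans (∙-cong (f≈ε x (here refl)) (fold-ε f xs (λ y y∈ → f≈ε y (there y∈)))) (identityˡ ε)

  fold-pick : ∀ {A : Set} (f : A → Carrier) {xs y} → Unique xs → y ∈ xs →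
              (∀ x → x ∈ xs → x ≢ y → f x ≈ ε) → foldr _∙_ ε (map f xs) ≈ f y
  fold-pick f {x ∷ xs} (x∉xs ∷ uniq) (here refl) others =
    ≈-trans (∙-cong ≈-refl (fold-ε f xs λ z z∈ → others z (there z∈) (All.lookup x∉xs z∈ ∘ sym)))
            (identityʳ (f x))
  fold-pick f {x ∷ xs} (x∉xs ∷ uniq) (there y∈) others =
    ≈-trans (∙-cong (others x (here refl) (All.lookup x∉xs y∈)) ≈-refl)
            (≈-trans (identityˡ _) (fold-pick f uniq y∈ (λ z z∈ → others z (there z∈))))

sumK-apply : ∀ {A : Set} (F : A → Kp) xs ρ → sumK (map F xs) ρ ≡ sum (map (λ x → F x ρ) xs)
sumK-apply F []       ρ = refl
sumK-apply F (x ∷ xs) ρ = cong (F x ρ +_) (sumK-apply F xs ρ)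

sumK-zero : ∀ {A : Set} (F : A → Kp) xs ρ → (∀ x → x ∈ xs → F x ρ ≡ 0) → sumK (map F xs) ρ ≡ 0
sumK-zero F xs ρ F≡0 =
  trans (sumK-apply F xs ρ) (fold-ε +-0-monoid (λ x → F x ρ) xs F≡0)

sumK-pick : ∀ {A : Set} (F : A → Kp) {xs y} ρ → Unique xs → y ∈ xs →
            (∀ x → x ∈ xs → x ≢ y → F x ρ ≡ 0) → sumK (map F xs) ρ ≡ F y ρ
sumK-pick F {xs} ρ uniq y∈ others =
  trans (sumK-apply F xs ρ) (fold-pick +-0-monoid (λ x → F x ρ) uniq y∈ others)

sumK-cong : ∀ {A : Set} (F G : A → Kp) xs ρ ρ′ → (∀ x → x ∈ xs → F x ρ ≡ G x ρ′) →
            sumK (map F xs) ρ ≡ sumK (map G xs) ρ′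
sumK-cong F G xs ρ ρ′ F≡G = begin
  sumK (map F xs) ρ            ≡⟨ sumK-apply F xs ρ ⟩
  sum (map (λ x → F x ρ) xs)   ≡⟨ cong sum (map-cong-local (All.tabulate (F≡G _))) ⟩
  sum (map (λ x → G x ρ′) xs)  ≡⟨ sumK-apply G xs ρ′ ⟨
  sumK (map G xs) ρ′           ∎
  where open ≡-Reasoning

sumK-∷ʳ : ∀ {A : Set} (F : A → Kp) xs x ρ → sumK (map F (xs ∷ʳ x)) ρ ≡ sumK (map F xs) ρ + F x ρ
sumK-∷ʳ F xs x ρ = begin
  sumK (map F (xs ∷ʳ x)) ρ                  ≡⟨ sumK-apply F (xs ∷ʳ x) ρ ⟩
  sum (map (λ y → F y ρ) (xs ∷ʳ x))         ≡⟨ cong sum (map-++ (λ y → F y ρ) xs (x ∷ [])) ⟩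
  sum (map (λ y → F y ρ) xs ++ F x ρ ∷ [])  ≡⟨ sum-++ (map (λ y → F y ρ) xs) (F x ρ ∷ []) ⟩
  sum (map (λ y → F y ρ) xs) + (F x ρ + 0)
    ≡⟨ cong₂ _+_ (sym (sumK-apply F xs ρ)) (+-identityʳ (F x ρ)) ⟩
  sumK (map F xs) ρ + F x ρ                 ∎
  where open ≡-Reasoning

concatMap-[] : ∀ {A B : Set} (f : A → List B) xs → (∀ x → x ∈ xs → f x ≡ []) → concatMap f xs ≡ []
concatMap-[] f = fold-ε (++-monoid _) f

concatMap-pick : ∀ {A B : Set} (f : A → List B) {xs y} → Unique xs → y ∈ xs →
                 (∀ x → x ∈ xs → x ≢ y → f x ≡ []) → concatMap f xs ≡ f y
concatMap-pick f = fold-pick (++-monoid _) f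

∈-range⁺ : ∀ {a b i} → a ≤ i → i < b → i ∈ range a b
∈-range⁺ {a} {b} {i} a≤i i<b =
  subst (_∈ range a b) (m+[n∸m]≡n a≤i) (∈-map⁺ (a +_) (∈-upTo⁺ (∸-monoˡ-< i<b a≤i)))

∈-range⁻ : ∀ {a b i} → i ∈ range a b → a ≤ i × i < b
∈-range⁻ {a} {b} i∈ with ∈-map⁻ (a +_) i∈
... | t , t∈ , refl = m≤m+n a t , (begin-strict
  a + t         <⟨ +-monoʳ-< a t<b∸a ⟩
  a + (b ∸ a)   ≡⟨ m+[n∸m]≡n (<⇒≤ a<b) ⟩
  b             ∎)
  where
  open ≤-Reasoning
  t<b∸a : t < b ∸ a
  t<b∸a = ∈-upTo⁻ t∈
  a<b : a < b
  a<b = m∸n≢0⇒n<m λ b∸a≡0 → n≮0 (subst (t <_) b∸a≡0 t<b∸a)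

range-unique : ∀ a b → Unique (range a b)
range-unique a b = Unique.map⁺ (+-cancelˡ-≡ a _ _) (Unique.upTo⁺ (b ∸ a))

range-∷ʳ : ∀ {a b} → a ≤ b → range a (suc b) ≡ range a b ∷ʳ b
range-∷ʳ {a} {b} a≤b = begin
  map (a +_) (upTo (suc b ∸ a))          ≡⟨ cong (map (a +_) ∘ upTo) (+-∸-assoc 1 a≤b) ⟩
  map (a +_) (upTo (suc (b ∸ a)))        ≡⟨ cong (map (a +_)) (upTo-∷ʳ (b ∸ a)) ⟨
  map (a +_) (upTo (b ∸ a) ∷ʳ (b ∸ a))   ≡⟨ map-++ (a +_) (upTo (b ∸ a)) _ ⟩
  range a b ∷ʳ (a + (b ∸ a))             ≡⟨ cong (range a b ∷ʳ_) (m+[n∸m]≡n a≤b) ⟩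
  range a b ∷ʳ b                         ∎
  where open ≡-Reasoning

-- Cancelling brackets

replicate-∷-comm : ∀ {A : Set} V (y : A) s → replicate V y ++ y ∷ s ≡ y ∷ replicate V y ++ s
replicate-∷-comm zero    y s = refl
replicate-∷-comm (suc V) y s = cong (y ∷_) (replicate-∷-comm V y s)

leftmostOpenGo-closers : ∀ u (x : Root) w → leftmostOpenGo (rep u cl x ++ w) [] ≡ leftmostOpenGo w []
leftmostOpenGo-closers zero    x w = refl
leftmostOpenGo-closers (suc u) x w = leftmostOpenGo-closers u x w

leftmostOpenGo-openers : ∀ V (y : Root) w s →
  leftmostOpenGo (rep V op y ++ w) s ≡ leftmostOpenGo w (replicate V y ++ s)
leftmostOpenGo-openers zero    y w s = refl
leftmostOpenGo-openers (suc V) y w s =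
  trans (leftmostOpenGo-openers V y w (y ∷ s)) (cong (leftmostOpenGo w) (replicate-∷-comm V y s))

leftmostOpenGo-cancel : ∀ W V (y z : Root) w →
  leftmostOpenGo (rep W cl z ++ w) (replicate V y) ≡ leftmostOpenGo w (replicate (V ∸ W) y)
leftmostOpenGo-cancel zero    V       y z w = refl
leftmostOpenGo-cancel (suc W) zero    y z w = leftmostOpenGo-closers W z w
leftmostOpenGo-cancel (suc W) (suc V) y z w = leftmostOpenGo-cancel W V y z w

leftmostOpen-closers : ∀ u (x : Root) → leftmostOpen (rep u cl x) ≡ nothing
leftmostOpen-closers u x = trans (cong (λ w → leftmostOpenGo w []) (sym (++-identityʳ (rep u cl x))))
                                 (leftmostOpenGo-closers u x [])

leftmostOpen-block : ∀ u V W (x y z : Root) →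
  leftmostOpen (rep u cl x ++ rep V op y ++ rep W cl z ++ rep u op x)
    ≡ lastM (replicate u x ++ replicate (V ∸ W) y)
leftmostOpen-block u V W x y z = begin
  leftmostOpenGo (rep u cl x ++ rep V op y ++ rep W cl z ++ rep u op x) []
    ≡⟨ leftmostOpenGo-closers u x _ ⟩
  leftmostOpenGo (rep V op y ++ rep W cl z ++ rep u op x) []
    ≡⟨ leftmostOpenGo-openers V y _ [] ⟩
  leftmostOpenGo (rep W cl z ++ rep u op x) (replicate V y ++ [])
    ≡⟨ cong (leftmostOpenGo (rep W cl z ++ rep u op x)) (++-identityʳ (replicate V y)) ⟩
  leftmostOpenGo (rep W cl z ++ rep u op x) (replicate V y)
    ≡⟨ leftmostOpenGo-cancel W V y z _ ⟩
  leftmostOpenGo (rep u op x) (replicate (V ∸ W) y)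
    ≡⟨ cong (λ w → leftmostOpenGo w (replicate (V ∸ W) y)) (sym (++-identityʳ (rep u op x))) ⟩
  leftmostOpenGo (rep u op x ++ []) (replicate (V ∸ W) y)
    ≡⟨ leftmostOpenGo-openers u x [] _ ⟩
  lastM (replicate u x ++ replicate (V ∸ W) y)
    ∎
  where open ≡-Reasoning

module _ {A : Set} where

  lastM-∷ : ∀ (a : A) ys {y} → lastM ys ≡ just y → lastM (a ∷ ys) ≡ just y
  lastM-∷ a (b ∷ ys) e = e

  lastM-++-replicate : ∀ xs D (y : A) → lastM (xs ++ replicate (suc D) y) ≡ just y
  lastM-++-replicate []       zero    y = refl
  lastM-++-replicate []       (suc D) y = lastM-++-replicate [] D y
  lastM-++-replicate (x ∷ xs) D       y = lastM-∷ x (xs ++ replicate (suc D) y) (lastM-++-replicate xs D y)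

  lastM-surplus : ∀ u V W (x y : A) → W < V → lastM (replicate u x ++ replicate (V ∸ W) y) ≡ just y
  lastM-surplus u V W x y W<V with V ∸ W in eq
  ... | zero  = contradiction eq (m>n⇒m∸n≢0 W<V)
  ... | suc D = lastM-++-replicate (replicate u x) D y

  lastM-balanced : ∀ u V W (x y : A) → V ≤ W → 0 < u →
                   lastM (replicate u x ++ replicate (V ∸ W) y) ≡ just x
  lastM-balanced (suc u) V W x y V≤W _ rewrite m≤n⇒m∸n≡0 V≤W =
    trans (cong lastM (++-identityʳ (replicate (suc u) x))) (lastM-++-replicate [] u x)

  ∈-lastM : ∀ (s : List A) {x} → lastM s ≡ just x → x ∈ s
  ∈-lastM (y ∷ [])     refl = here refl
  ∈-lastM (y ∷ z ∷ s)  e    = there (∈-lastM (z ∷ s) e)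

  ∈-leftmostOpenGo : ∀ w s {x : A} → leftmostOpenGo w s ≡ just x → (op , x) ∈ w ⊎ x ∈ s
  ∈-leftmostOpenGo []             s       e = inj₂ (∈-lastM s e)
  ∈-leftmostOpenGo ((op , a) ∷ w) s       e with ∈-leftmostOpenGo w (a ∷ s) e
  ... | inj₁ x∈w         = inj₁ (there x∈w)
  ... | inj₂ (here refl) = inj₁ (here refl)
  ... | inj₂ (there x∈s) = inj₂ x∈s
  ∈-leftmostOpenGo ((cl , a) ∷ w) []      e with ∈-leftmostOpenGo w [] e
  ... | inj₁ x∈w = inj₁ (there x∈w)
  ∈-leftmostOpenGo ((cl , a) ∷ w) (b ∷ s) e with ∈-leftmostOpenGo w s e
  ... | inj₁ x∈w = inj₁ (there x∈w)
  ... | inj₂ x∈s = inj₂ (there x∈s)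

  ∈-leftmostOpen : ∀ w {x : A} → leftmostOpen w ≡ just x → (op , x) ∈ w
  ∈-leftmostOpen w e with ∈-leftmostOpenGo w [] e
  ... | inj₁ x∈w = x∈w

cnt-∷ : ∀ x y ys → cnt x (y ∷ ys) ≡ cnt x (y ∷ []) + cnt x ys
cnt-∷ x y ys with eqL x y
... | true  = refl
... | false = refl

cnt-++ : ∀ x xs ys → cnt x (xs ++ ys) ≡ cnt x xs + cnt x ys
cnt-++ x []       ys = refl
cnt-++ x (y ∷ xs) ys = begin
  cnt x (y ∷ xs ++ ys)                     ≡⟨ cnt-∷ x y (xs ++ ys) ⟩
  cnt x (y ∷ []) + cnt x (xs ++ ys)        ≡⟨ cong (cnt x (y ∷ []) +_) (cnt-++ x xs ys) ⟩
  cnt x (y ∷ []) + (cnt x xs + cnt x ys)   ≡⟨ +-assoc (cnt x (y ∷ [])) _ _ ⟨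
  cnt x (y ∷ []) + cnt x xs + cnt x ys     ≡⟨ cong (_+ cnt x ys) (cnt-∷ x y xs) ⟨
  cnt x (y ∷ xs) + cnt x ys                ∎
  where open ≡-Reasoning

cnt-insertAt : ∀ x r p y → cnt x (insertAt r p y) ≡ cnt x r + cnt x (y ∷ [])
cnt-insertAt x r p y = begin
  cnt x (take p r ++ y ∷ drop p r)            ≡⟨ cnt-++ x (take p r) (y ∷ drop p r) ⟩
  cnt x (take p r) + cnt x (y ∷ drop p r)     ≡⟨ cong (cnt x (take p r) +_) (cnt-∷ x y (drop p r)) ⟩
  cnt x (take p r) + (⟦y⟧ + cnt x (drop p r))  ≡⟨ swap-last (cnt x (take p r)) ⟦y⟧ _ ⟩
  cnt x (take p r) + cnt x (drop p r) + ⟦y⟧    ≡⟨ cong (_+ ⟦y⟧) (cnt-++ x (take p r) (drop p r)) ⟨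
  cnt x (take p r ++ drop p r) + ⟦y⟧           ≡⟨ cong (λ s → cnt x s + ⟦y⟧) (take++drop≡id p r) ⟩
  cnt x r + ⟦y⟧                                ∎
  where
  open ≡-Reasoning
  ⟦y⟧ = cnt x (y ∷ [])
  swap-last : ∀ a b c → a + (b + c) ≡ a + c + b
  swap-last a b c = trans (cong (a +_) (+-comm b c)) (sym (+-assoc a c b))

cnt-shaded : ∀ {i} x r → All (_≡ num i) r → eqL x (num i) ≡ false → cnt x r ≡ 0
cnt-shaded x []       []            _ = refl
cnt-shaded x (y ∷ ys) (refl ∷ rest) e rewrite e = cnt-shaded x ys rest e

cnt-modifyAt : ∀ r p (f : Letter → Letter) → p < length r → ∀ x →
               cnt x (modifyAt r p f) + cnt x (nthD zer r p ∷ []) ≡ cnt x r + cnt x (f (nthD zer r p) ∷ [])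
cnt-modifyAt (y ∷ ys) zero f _ x = begin
  cnt x (f y ∷ ys) + cnt x (y ∷ [])                ≡⟨ cong (_+ cnt x (y ∷ [])) (cnt-∷ x (f y) ys) ⟩
  cnt x (f y ∷ []) + cnt x ys + cnt x (y ∷ [])     ≡⟨ exchange (cnt x (f y ∷ [])) (cnt x ys) _ ⟩
  cnt x (y ∷ []) + cnt x ys + cnt x (f y ∷ [])     ≡⟨ cong (_+ cnt x (f y ∷ [])) (cnt-∷ x y ys) ⟨
  cnt x (y ∷ ys) + cnt x (f y ∷ [])                ∎
  where
  open ≡-Reasoning
  exchange : ∀ a b c → a + b + c ≡ c + b + a
  exchange = solve-∀
cnt-modifyAt (y ∷ ys) (suc p) f (s≤s p<len) x = begin
  cnt x (y ∷ modifyAt ys p f) + ⟦o⟧        ≡⟨ cong (_+ ⟦o⟧) (cnt-∷ x y (modifyAt ys p f)) ⟩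
  ⟦y⟧ + cnt x (modifyAt ys p f) + ⟦o⟧      ≡⟨ +-assoc ⟦y⟧ _ _ ⟩
  ⟦y⟧ + (cnt x (modifyAt ys p f) + ⟦o⟧)    ≡⟨ cong (⟦y⟧ +_) (cnt-modifyAt ys p f p<len x) ⟩
  ⟦y⟧ + (cnt x ys + ⟦fo⟧)                 ≡⟨ +-assoc ⟦y⟧ _ _ ⟨
  ⟦y⟧ + cnt x ys + ⟦fo⟧                   ≡⟨ cong (_+ ⟦fo⟧) (cnt-∷ x y ys) ⟨
  cnt x (y ∷ ys) + ⟦fo⟧                   ∎
  where
  open ≡-Reasoning
  o = nthD zer ys p
  ⟦y⟧ ⟦o⟧ ⟦fo⟧ : ℕ
  ⟦y⟧   = cnt x (y ∷ [])
  ⟦o⟧   = cnt x (o ∷ [])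
  ⟦fo⟧  = cnt x (f o ∷ [])

record Replaces (old new : Letter) (r r′ : List Letter) : Set where
  field counts : ∀ x → cnt x r′ + cnt x (old ∷ []) ≡ cnt x r + cnt x (new ∷ [])

modifyAt-replaces : ∀ r p (f : Letter → Letter) → p < length r →
                    Replaces (nthD zer r p) (f (nthD zer r p)) r (modifyAt r p f)
modifyAt-replaces r p f p<len = record { counts = cnt-modifyAt r p f p<len }

module _ {old new r r′} (replaces : Replaces old new r r′) where
  open Replaces replaces

  Replaces-untouched : ∀ x → eqL x old ≡ false → eqL x new ≡ false → cnt x r′ ≡ cnt x r
  Replaces-untouched x ≢old ≢new with counts x
  ... | eq rewrite ≢old | ≢new = trans (sym (+-identityʳ _)) (trans eq (+-identityʳ _))

  Replaces-removed : ∀ x → eqL x old ≡ true → eqL x new ≡ false → cnt x r ≡ suc (cnt x r′)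
  Replaces-removed x ≡old ≢new with counts x
  ... | eq rewrite ≡old | ≢new = trans (sym (+-identityʳ _)) (trans (sym eq) (+-comm _ 1))

  Replaces-added : ∀ x → eqL x old ≡ false → eqL x new ≡ true → cnt x r′ ≡ suc (cnt x r)
  Replaces-added x ≢old ≡new with counts x
  ... | eq rewrite ≢old | ≡new = trans (sym (+-identityʳ _)) (trans eq (+-comm _ 1))

module _ {A : Set} (d : A) where

  nthD-modifyAt-same : ∀ xs p (f : A → A) → p < length xs → nthD d (modifyAt xs p f) p ≡ f (nthD d xs p)
  nthD-modifyAt-same (x ∷ xs) zero    f _           = refl
  nthD-modifyAt-same (x ∷ xs) (suc p) f (s≤s p<len) = nthD-modifyAt-same xs p f p<len

  nthD-modifyAt-other : ∀ xs p q (f : A → A) → q ≢ p → nthD d (modifyAt xs p f) q ≡ nthD d xs q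
  nthD-modifyAt-other []       p       q       f q≢p = refl
  nthD-modifyAt-other (x ∷ xs) zero    zero    f q≢p = contradiction refl q≢p
  nthD-modifyAt-other (x ∷ xs) zero    (suc q) f q≢p = refl
  nthD-modifyAt-other (x ∷ xs) (suc p) zero    f q≢p = refl
  nthD-modifyAt-other (x ∷ xs) (suc p) (suc q) f q≢p = nthD-modifyAt-other xs p q f (q≢p ∘ cong suc)

length-modifyAt : ∀ {A : Set} (xs : List A) p f → length (modifyAt xs p f) ≡ length xs
length-modifyAt []       p       f = refl
length-modifyAt (x ∷ xs) zero    f = refl
length-modifyAt (x ∷ xs) (suc p) f = cong suc (length-modifyAt xs p f)

All-insertAt : ∀ {P : Letter → Set} r p {y} → All P r → P y → All P (insertAt r p y)
All-insertAt r        zero    all       py = py ∷ all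
All-insertAt []       (suc p) []        py = py ∷ []
All-insertAt (x ∷ r)  (suc p) (px ∷ all) py = px ∷ All-insertAt r p all py

length-modifyRow : ∀ T j f → length (modifyRow T j f) ≡ length T
length-modifyRow T zero    f = refl
length-modifyRow T (suc j) f = length-modifyAt T j f

rowAt-modifyRow-same : ∀ T j f → 1 ≤ j → j ≤ length T → rowAt (modifyRow T j f) j ≡ f (rowAt T j)
rowAt-modifyRow-same T (suc j) f _ j<len = nthD-modifyAt-same [] T j f j<len

rowAt-modifyRow-other : ∀ T j i f → i ≢ j → rowAt (modifyRow T j f) i ≡ rowAt T i
rowAt-modifyRow-other T zero    i       f i≢j = refl
rowAt-modifyRow-other T (suc j) zero    f i≢j = refl
rowAt-modifyRow-other T (suc j) (suc i) f i≢j = nthD-modifyAt-other [] T j i f (i≢j ∘ cong suc)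

rowAt-insertColumn : ∀ T p i → 1 ≤ i → i ≤ length T →
                     rowAt (insertColumn T p) i ≡ insertAt (rowAt T i) p (num i)
rowAt-insertColumn T p (suc i) _ i<len = go id T i i<len
  where
  go : ∀ (f : ℕ → ℕ) (rows : Tab) q → q < length rows →
       nthD [] (map (λ { (k , r) → insertAt r p (num (suc k)) }) (zip (applyUpTo f (length rows)) rows)) q
         ≡ insertAt (nthD [] rows q) p (num (suc (f q)))
  go f (r ∷ rows) zero    _           = refl
  go f (r ∷ rows) (suc q) (s≤s q<len) = go (f ∘ suc) rows q q<len

-- The box carrying the leftmost '(' of the n-signature

∈-concatMap⁻ : ∀ {A B : Set} (f : A → List B) xs {v} → v ∈ concatMap f xs →
               ∃ λ x → x ∈ xs × v ∈ f x
∈-concatMap⁻ f xs v∈ = find (Any.map⁻ (∈-concat⁻ (map f xs) v∈))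

∈-indexed⁻ : ∀ {A : Set} (d : A) (f : ℕ → ℕ) xs {q x} → (q , x) ∈ zip (applyUpTo f (length xs)) xs →
             ∃ λ t → q ≡ f t × t < length xs × x ≡ nthD d xs t
∈-indexed⁻ d f (y ∷ ys) (here refl) = 0 , refl , s≤s z≤n , refl
∈-indexed⁻ d f (y ∷ ys) (there q∈) with ∈-indexed⁻ d (f ∘ suc) ys q∈
... | t , q≡ , t<len , x≡ = suc t , q≡ , s≤s t<len , x≡

∈-signature⁻ : ∀ ty n T {j p} → (op , (j , p)) ∈ signatureT ty n T →
               p < length (rowAt T j) × op ∈ sigLetter ty n (entry T j p)
∈-signature⁻ ty n T o∈
  with i , _ , o∈row ← ∈-concatMap⁻ (λ i → rowSig ty n i (rowAt T i)) (range 1 (suc n)) o∈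
  with (q , x) , qx∈ , o∈box ← ∈-concatMap⁻ _ (reverse (indexed (rowAt T i))) o∈row
  with b , b∈ , refl ← ∈-map⁻ (λ b → (b , (i , q))) o∈box
  with t , refl , t<len , refl ← ∈-indexed⁻ zer id (rowAt T i) (Any.reverse⁻ qx∈)
  = t<len , b∈

data LetterStep : Ty → ℕ → Letter → Letter → Set where
  n↦0 : ∀ {n} → LetterStep B n (num n) zer
  0↦n̄ : ∀ {n} → LetterStep B n zer (bar n)
  n↦n̄ : ∀ {n} → LetterStep C n (num n) (bar n)

opening-step : ∀ ty n x → op ∈ sigLetter ty n x → LetterStep ty n x (succJ ty n x)
opening-step B n (num i) o∈ with i ≡ᵇ n in eq
... | true rewrite ≡ᵇ⇒≡ i n (Equivalence.from T-≡ eq) | ≮⇒<ᵇ-false (<-irrefl {n} refl) = n↦0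
opening-step B n zer     o∈ = 0↦n̄
opening-step B n (bar i) o∈ with i ≡ᵇ n
opening-step B n (bar i) (here ())         | true
opening-step B n (bar i) (there (here ())) | true
opening-step C n (num i) o∈ with i ≡ᵇ n in eq
... | true rewrite ≡ᵇ⇒≡ i n (Equivalence.from T-≡ eq) | ≮⇒<ᵇ-false (<-irrefl {n} refl) = n↦n̄
opening-step C n (bar i) o∈ with i ≡ᵇ n
opening-step C n (bar i) (here ()) | true

fT-at : ∀ ty n T {j p} → leftmostOpenT ty n T ≡ just (j , p) →
        fT ty n T ≡ (if (j ≡ᵇ n) ∧ eqL (entry T j p) (num n)
                     then insertColumn (modifyRow T j (λ r → modifyAt r p (succJ ty n))) p
                     else modifyRow T j (λ r → modifyAt r p (succJ ty n)))
fT-at ty n T lo rewrite lo = refl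

-- Ψ of a single row

nums bars pairs : List Letter → ℕ → ℕ
nums r k  = cnt (num k) r
bars r k  = cnt (bar k) r
pairs r k = nums r k ⊓ bars r k

ownBarTerm : ℕ → List Letter → Kp
ownBarTerm j r = scale (bars r j) (one (β j j) ⊕ one (γ j (suc j)))

pairTerm numTerm barTerm : ℕ → List Letter → ℕ → Kp
pairTerm j r k = scale (pairs r k) (one (β j k) ⊕ one (γ j (suc k)))
numTerm  j r k = scale (nums r k ∸ pairs r k) (one (β j (k ∸ 1)))
barTerm  j r k = scale (bars r k ∸ pairs r k) (one (γ j k))

-- the contribution of the boxes j̄, k, k̄ (j < k < n) of row j
ΨrowRest : ℕ → ℕ → List Letter → Kp
ΨrowRest n j r =
  ownBarTerm j r ⊕ sumK (map (pairTerm j r) ks) ⊕ sumK (map (numTerm j r) ks) ⊕ sumK (map (barTerm j r) ks)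
  where ks = range (suc j) n

-- The roots at which the boxes n, 0, n̄ of row j < n contribute: pairs (n, n̄) and zeros at
-- β_{j,n} (type B) or γ_{j,j} (type C), unpaired n at β_{j,n-1}, unpaired n̄ at γ_{j,n}.
data Slot : Set where
  paired surplusN surplusBar : Slot

Coeffs : Set
Coeffs = Slot → ℕ

onSlots : (Slot → Root) → Coeffs → Kp
onSlots R h ρ =
  h paired * one (R paired) ρ + h surplusN * one (R surplusN) ρ + h surplusBar * one (R surplusBar) ρ

slotRoot : Ty → ℕ → ℕ → Slot → Root
slotRoot ty n j surplusN   = β j (n ∸ 1)
slotRoot ty n j surplusBar = γ j n
slotRoot B  n j paired     = β j n
slotRoot C  n j paired     = γ j j

-- coefficients for a row with a boxes n, b boxes n̄ and z boxes 0
slotCoeff : Ty → ℕ → ℕ → ℕ → Coeffs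
slotCoeff ty a b z surplusN   = a ∸ a ⊓ b
slotCoeff ty a b z surplusBar = b ∸ a ⊓ b
slotCoeff B  a b z paired     = 2 * (a ⊓ b) + z
slotCoeff C  a b z paired     = a ⊓ b

rowCoeff : Ty → ℕ → List Letter → Coeffs
rowCoeff ty n r = slotCoeff ty (nums r n) (bars r n) (cnt zer r)

sumK-range-∷ʳ : ∀ (F : ℕ → Kp) {a b} ρ → a ≤ b →
                sumK (map F (range a (suc b))) ρ ≡ sumK (map F (range a b)) ρ + F b ρ
sumK-range-∷ʳ F {a} {b} ρ a≤b =
  trans (cong (λ ks → sumK (map F ks) ρ) (range-∷ʳ a≤b)) (sumK-∷ʳ F (range a b) b ρ)

ΨrowLow-regroup : ∀ n j r ρ {P Q} → j < n → P ≡ Q →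
  P + ownBarTerm j r ρ + sumK (map (pairTerm j r) (range (suc j) n)) ρ
    + sumK (map (numTerm j r) (range (suc j) (suc n))) ρ + sumK (map (barTerm j r) (range (suc j) (suc n))) ρ
  ≡ ΨrowRest n j r ρ + (Q + numTerm j r n ρ + barTerm j r n ρ)
ΨrowLow-regroup n j r ρ {P} j<n refl =
  trans (cong₂ (λ u v → P + ownBarTerm j r ρ + S pairTerm + u + v) (last numTerm) (last barTerm))
        (regroup P (ownBarTerm j r ρ) (S pairTerm) (S numTerm) (S barTerm) (numTerm j r n ρ) (barTerm j r n ρ))
  where
  S : (ℕ → List Letter → ℕ → Kp) → ℕ
  S F = sumK (map (F j r) (range (suc j) n)) ρ
  last : ∀ F → sumK (map (F j r) (range (suc j) (suc n))) ρ ≡ S F + F j r n ρ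
  last F = sumK-range-∷ʳ (F j r) ρ j<n
  regroup : ∀ p d s₁ s₂ s₃ t₂ t₃ →
            p + d + s₁ + (s₂ + t₂) + (s₃ + t₃) ≡ d + s₁ + s₂ + s₃ + (p + t₂ + t₃)
  regroup = solve-∀

ΨrowLow-split : ∀ ty n j r ρ → j < n →
  ΨrowLow ty n j r ρ ≡ ΨrowRest n j r ρ + onSlots (slotRoot ty n j) (rowCoeff ty n r) ρ
ΨrowLow-split B n j r ρ j<n = ΨrowLow-regroup n j r ρ j<n (sym (*-distribʳ-+ o (2 * pairs r n) (cnt zer r)))
  where o = one (β j n) ρ
ΨrowLow-split C n j r ρ j<n = ΨrowLow-regroup n j r ρ j<n (+-identityʳ _)

ΨrowRest-avoided : ∀ n j r ρ → one (β j j) ρ ≡ 0 → one (γ j (suc j)) ρ ≡ 0 →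
  (∀ k → suc j ≤ k → k < n → one (β j k) ρ ≡ 0 × one (γ j (suc k)) ρ ≡ 0
                               × one (β j (k ∸ 1)) ρ ≡ 0 × one (γ j k) ρ ≡ 0) →
  ΨrowRest n j r ρ ≡ 0
ΨrowRest-avoided n j r ρ e₁ e₂ avoids =
  cong₂ _+_ (cong₂ _+_ (cong₂ _+_ (n≡0⇒m*n≡0 {bars r j} (cong₂ _+_ e₁ e₂))
                                  (vanish pairTerm pair≡0))
                       (vanish numTerm num≡0))
            (vanish barTerm bar≡0)
  where
  vanish : ∀ F → (∀ k → suc j ≤ k → k < n → F j r k ρ ≡ 0) →
           sumK (map (F j r) (range (suc j) n)) ρ ≡ 0
  vanish F F≡0 = sumK-zero (F j r) _ ρ λ k k∈ → uncurry (F≡0 k) (∈-range⁻ k∈)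
  pair≡0 : ∀ k → suc j ≤ k → k < n → pairTerm j r k ρ ≡ 0
  num≡0  : ∀ k → suc j ≤ k → k < n → numTerm j r k ρ ≡ 0
  bar≡0  : ∀ k → suc j ≤ k → k < n → barTerm j r k ρ ≡ 0
  pair≡0 k j<k k<n with a , b , _ ← avoids k j<k k<n = n≡0⇒m*n≡0 {pairs r k} (cong₂ _+_ a b)
  num≡0  k j<k k<n with _ , _ , c , _ ← avoids k j<k k<n = n≡0⇒m*n≡0 {nums r k ∸ pairs r k} c
  bar≡0  k j<k k<n with _ , _ , _ , d ← avoids k j<k k<n = n≡0⇒m*n≡0 {bars r k ∸ pairs r k} d

ΨrowRest-supported : ∀ n j r → SupportedOnRow j (ΨrowRest n j r)
ΨrowRest-supported n j r ρ ρ∉j =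
  ΨrowRest-avoided n j r ρ (off (β j j) refl) (off (γ j (suc j)) refl)
    λ k _ _ → off (β j k) refl , off (γ j (suc k)) refl , off (β j (k ∸ 1)) refl , off (γ j k) refl
  where
  off : ∀ R → rowOf R ≡ j → one R ρ ≡ 0
  off R refl = one-otherRow {R} {ρ} (ρ∉j ∘ sym)

ΨrowRest-paired≡0 : ∀ ty n j r → j < n → ΨrowRest n j r (slotRoot ty n j paired) ≡ 0
ΨrowRest-paired≡0 B n j r j<n =
  ΨrowRest-avoided n j r (β j n) (ββ (<⇒≢ j<n)) refl
    λ k _ k<n → ββ (<⇒≢ k<n) , refl , ββ (<⇒≢ (≤-<-trans (m∸n≤m k 1) k<n)) , refl
  where
  ββ : ∀ {k} → k ≢ n → one (β j k) (β j n) ≡ 0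
  ββ {k} k≢n = one-≢ (β j k) (β j n) (k≢n ∘ λ { refl → refl })
ΨrowRest-paired≡0 C n j r j<n =
  ΨrowRest-avoided n j r (γ j j) refl (γγ (<⇒≢ (n<1+n j) ∘ sym))
    λ k j<k _ → refl , γγ (<⇒≢ (m<n⇒m<1+n j<k) ∘ sym) , refl , γγ (<⇒≢ j<k ∘ sym)
  where
  γγ : ∀ {k} → k ≢ j → one (γ j k) (γ j j) ≡ 0
  γγ {k} k≢j = one-≢ (γ j k) (γ j j) (k≢j ∘ λ { refl → refl })

pair-symm : ∀ j k m → one (β j k) (β j m) + one (γ j (suc k)) (β j m)
                     ≡ one (β j k) (γ j (suc m)) + one (γ j (suc k)) (γ j (suc m))
pair-symm j k m = +-identityʳ (one (β j k) (β j m))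

-- Only the terms β_{j,k} + γ_{j,k+1} of pairs (k, k̄) can be nonzero at these two roots,
-- and they take the same value at both.
ΨrowRest-surplusN≡surplusBar : ∀ n′ j r →
  ΨrowRest (suc n′) j r (β j n′) ≡ ΨrowRest (suc n′) j r (γ j (suc n′))
ΨrowRest-surplusN≡surplusBar n′ j r =
  cong₂ _+_ (cong₂ _+_ (cong₂ _+_ (cong (bars r j *_) (pair-symm j j n′)) pairs≡) nums≡) bars≡
  where
  ks = range (suc j) (suc n′)
  pairs≡ : sumK (map (pairTerm j r) ks) (β j n′) ≡ sumK (map (pairTerm j r) ks) (γ j (suc n′))
  pairs≡ = sumK-cong (pairTerm j r) (pairTerm j r) ks _ _ λ k _ → cong (pairs r k *_) (pair-symm j k n′)
  nums≡ : sumK (map (numTerm j r) ks) (β j n′) ≡ sumK (map (numTerm j r) ks) (γ j (suc n′))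
  nums≡ = trans (sumK-zero (numTerm j r) ks _ λ k k∈ →
                  n≡0⇒m*n≡0 {nums r k ∸ pairs r k} (uncurry (ββ k) (∈-range⁻ k∈)))
                (sym (sumK-zero (numTerm j r) ks _ λ k _ → n≡0⇒m*n≡0 {nums r k ∸ pairs r k} refl))
    where
    ββ : ∀ k → suc j ≤ k → k < suc n′ → one (β j (k ∸ 1)) (β j n′) ≡ 0
    ββ (suc k) _ (s≤s k<n′) = one-≢ (β j k) (β j n′) λ { refl → <-irrefl refl k<n′ }
  bars≡ : sumK (map (barTerm j r) ks) (β j n′) ≡ sumK (map (barTerm j r) ks) (γ j (suc n′))
  bars≡ = trans (sumK-zero (barTerm j r) ks _ λ k _ → n≡0⇒m*n≡0 {bars r k ∸ pairs r k} refl)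
                (sym (sumK-zero (barTerm j r) ks _ λ k k∈ →
                  n≡0⇒m*n≡0 {bars r k ∸ pairs r k} (γγ k (∈-range⁻ k∈))))
    where
    γγ : ∀ k → suc j ≤ k × k < suc n′ → one (γ j k) (γ j (suc n′)) ≡ 0
    γγ k (_ , k<n) = one-≢ (γ j k) (γ j (suc n′)) λ { refl → <-irrefl refl k<n }

ΨrowRest-cong : ∀ n j r r′ ρ → j < n → (∀ k → j < k → k < n → nums r′ k ≡ nums r k) →
                (∀ k → j ≤ k → k < n → bars r′ k ≡ bars r k) →
                ΨrowRest n j r′ ρ ≡ ΨrowRest n j r ρ
ΨrowRest-cong n j r r′ ρ j<n nums≡ bars≡ =
  cong₂ _+_ (cong₂ _+_ (cong₂ _+_ (cong₂ _*_ (bars≡ j ≤-refl j<n) refl)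
                                  (terms pairTerm λ k j<k k<n → cong₂ _*_ (pairs≡ j<k k<n) refl))
                       (terms numTerm λ k j<k k<n → cong₂ _*_ (surplus nums≡ j<k k<n) refl))
            (terms barTerm λ k j<k k<n → cong₂ _*_ (surplus (λ k j<k → bars≡ k (<⇒≤ j<k)) j<k k<n) refl)
  where
  pairs≡ : ∀ {k} → j < k → k < n → pairs r′ k ≡ pairs r k
  pairs≡ {k} j<k k<n = cong₂ _⊓_ (nums≡ k j<k k<n) (bars≡ k (<⇒≤ j<k) k<n)
  surplus : ∀ {f : List Letter → ℕ → ℕ} → (∀ k → j < k → k < n → f r′ k ≡ f r k) →
            ∀ {k} → j < k → k < n → f r′ k ∸ pairs r′ k ≡ f r k ∸ pairs r k
  surplus f≡ {k} j<k k<n = cong₂ _∸_ (f≡ k j<k k<n) (pairs≡ j<k k<n)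
  terms : ∀ F → (∀ k → j < k → k < n → F j r′ k ρ ≡ F j r k ρ) →
          sumK (map (F j r′) (range (suc j) n)) ρ ≡ sumK (map (F j r) (range (suc j) n)) ρ
  terms F F≡ = sumK-cong (F j r′) (F j r) _ ρ ρ λ k k∈ → uncurry (F≡ k) (∈-range⁻ k∈)

ΨrowRest-[] : ∀ n j ρ → ΨrowRest n j [] ρ ≡ 0
ΨrowRest-[] n j ρ =
  cong₂ _+_ (cong₂ _+_ (vanish pairTerm λ _ → refl) (vanish numTerm λ _ → refl))
            (vanish barTerm λ _ → refl)
  where
  vanish : ∀ F → (∀ k → F j [] k ρ ≡ 0) → sumK (map (F j []) (range (suc j) n)) ρ ≡ 0
  vanish F F≡0 = sumK-zero (F j []) (range (suc j) n) ρ λ k _ → F≡0 k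

one-apart : ∀ {R : Slot → Root} → Injective _≡_ _≡_ R → ∀ s t → s ≢ t → one (R s) (R t) ≡ 0
one-apart {R} inj s t s≢t = one-≢ (R s) (R t) (s≢t ∘ inj)

onSlots-at : ∀ {R} → Injective _≡_ _≡_ R → ∀ h s → onSlots R h (R s) ≡ h s
onSlots-at {R} inj h paired
  rewrite one-same (R paired) | one-apart inj surplusN paired (λ ()) | one-apart inj surplusBar paired (λ ())
        | *-identityʳ (h paired) | *-zeroʳ (h surplusN) | *-zeroʳ (h surplusBar)
  = trans (+-identityʳ _) (+-identityʳ _)
onSlots-at {R} inj h surplusN
  rewrite one-same (R surplusN) | one-apart inj paired surplusN (λ ()) | one-apart inj surplusBar surplusN (λ ())
        | *-identityʳ (h surplusN) | *-zeroʳ (h paired) | *-zeroʳ (h surplusBar) = +-identityʳ (h surplusN)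
onSlots-at {R} inj h surplusBar
  rewrite one-same (R surplusBar) | one-apart inj paired surplusBar (λ ())
        | one-apart inj surplusN surplusBar (λ ())
        | *-identityʳ (h surplusBar) | *-zeroʳ (h paired) | *-zeroʳ (h surplusN) = refl

onSlots-vanishes : ∀ R h ρ → (∀ s → h s * one (R s) ρ ≡ 0) → onSlots R h ρ ≡ 0
onSlots-vanishes R h ρ terms = cong₂ _+_ (cong₂ _+_ (terms paired) (terms surplusN)) (terms surplusBar)

slotRoot-row : ∀ ty n j s → rowOf (slotRoot ty n j s) ≡ j
slotRoot-row ty n j surplusN   = refl
slotRoot-row ty n j surplusBar = refl
slotRoot-row B  n j paired     = refl
slotRoot-row C  n j paired     = refl

rowCoeff-zero : ∀ ty n r → nums r n ≡ 0 → bars r n ≡ 0 → cnt zer r ≡ 0 →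
                ∀ s → rowCoeff ty n r s ≡ 0
rowCoeff-zero ty n r a≡0 b≡0 z≡0 s rewrite a≡0 | b≡0 | z≡0 = zero-coeff ty s
  where
  zero-coeff : ∀ ty s → slotCoeff ty 0 0 0 s ≡ 0
  zero-coeff ty surplusN   = refl
  zero-coeff ty surplusBar = refl
  zero-coeff B  paired     = refl
  zero-coeff C  paired     = refl

topRoot : Ty → ℕ → Root
topRoot B n = β n n
topRoot C n = γ n n

topRoot-row : ∀ ty n → rowOf (topRoot ty n) ≡ n
topRoot-row B n = refl
topRoot-row C n = refl

topCoeff : Ty → ℕ → List Letter → ℕ
topCoeff B n r = cnt zer r + 2 * bars r n
topCoeff C n r = bars r n

ΨrowTop-value : ∀ ty n r ρ → ΨrowTop ty n r ρ ≡ topCoeff ty n r * one (topRoot ty n) ρ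
ΨrowTop-value B n r ρ = sym (*-distribʳ-+ (one (β n n) ρ) (cnt zer r) (2 * bars r n))
ΨrowTop-value C n r ρ = refl

Ψrow-low : ∀ ty n j r → j < n → Ψrow ty n j r ≡ ΨrowLow ty n j r
Ψrow-low ty n j r j<n rewrite <⇒<ᵇ-true j<n = refl

Ψrow-top : ∀ ty n r → Ψrow ty n n r ≡ ΨrowTop ty n r
Ψrow-top ty n r rewrite ≮⇒<ᵇ-false (<-irrefl {n} refl) = refl

Ψrow-split : ∀ ty n j r ρ → j < n →
  Ψrow ty n j r ρ ≡ ΨrowRest n j r ρ + onSlots (slotRoot ty n j) (rowCoeff ty n r) ρ
Ψrow-split ty n j r ρ j<n = trans (cong-app (Ψrow-low ty n j r j<n) ρ) (ΨrowLow-split ty n j r ρ j<n)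

Ψrow-top-value : ∀ ty n r ρ → Ψrow ty n n r ρ ≡ topCoeff ty n r * one (topRoot ty n) ρ
Ψrow-top-value ty n r ρ = trans (cong-app (Ψrow-top ty n r) ρ) (ΨrowTop-value ty n r ρ)

Ψrow-supported : ∀ ty n j r → j ≤ n → SupportedOnRow j (Ψrow ty n j r)
Ψrow-supported ty n j r j≤n ρ ρ∉j with m≤n⇒m<n∨m≡n j≤n
... | inj₁ j<n = begin
  Ψrow ty n j r ρ                                                   ≡⟨ Ψrow-split ty n j r ρ j<n ⟩
  ΨrowRest n j r ρ + onSlots (slotRoot ty n j) (rowCoeff ty n r) ρ  ≡⟨ cong₂ _+_ rest≡0 slots≡0 ⟩
  0                                                                 ∎
  where
  open ≡-Reasoning
  off : ∀ s → one (slotRoot ty n j s) ρ ≡ 0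
  off s = one-otherRow {slotRoot ty n j s} {ρ} λ e → ρ∉j (trans (sym e) (slotRoot-row ty n j s))
  slots≡0 : onSlots (slotRoot ty n j) (rowCoeff ty n r) ρ ≡ 0
  slots≡0 = onSlots-vanishes (slotRoot ty n j) (rowCoeff ty n r) ρ λ s →
              n≡0⇒m*n≡0 {rowCoeff ty n r s} (off s)
  rest≡0 : ΨrowRest n j r ρ ≡ 0
  rest≡0 = ΨrowRest-supported n j r ρ ρ∉j
... | inj₂ refl =
  trans (Ψrow-top-value ty j r ρ) (n≡0⇒m*n≡0 {topCoeff ty j r} (one-otherRow {topRoot ty j} {ρ} top∉))
  where
  top∉ : rowOf (topRoot ty j) ≢ rowOf ρ
  top∉ e = ρ∉j (trans (sym e) (topRoot-row ty j))

Ψrow-shaded : ∀ ty n i r ρ → i ≤ n → All (_≡ num i) r → Ψrow ty n i r ρ ≡ 0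
Ψrow-shaded ty n i r ρ i≤n shaded with m≤n⇒m<n∨m≡n i≤n
... | inj₁ i<n = begin
  Ψrow ty n i r ρ                                                   ≡⟨ Ψrow-split ty n i r ρ i<n ⟩
  ΨrowRest n i r ρ + onSlots (slotRoot ty n i) (rowCoeff ty n r) ρ  ≡⟨ cong₂ _+_ rest≡0 slots≡0 ⟩
  0                                                                 ∎
  where
  open ≡-Reasoning
  nums≡0 : ∀ k → k ≢ i → nums r k ≡ 0
  nums≡0 k k≢i = cnt-shaded (num k) r shaded (≢⇒≡ᵇ-false k≢i)
  bars≡0 : ∀ k → bars r k ≡ 0
  bars≡0 k = cnt-shaded (bar k) r shaded refl
  rest≡0 : ΨrowRest n i r ρ ≡ 0
  rest≡0 = trans (ΨrowRest-cong n i [] r ρ i<n (λ k i<k _ → nums≡0 k (<⇒≢ i<k ∘ sym))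
                                               (λ k _ _ → bars≡0 k))
                 (ΨrowRest-[] n i ρ)
  slots≡0 : onSlots (slotRoot ty n i) (rowCoeff ty n r) ρ ≡ 0
  slots≡0 = onSlots-vanishes (slotRoot ty n i) (rowCoeff ty n r) ρ λ s →
    cong (_* one (slotRoot ty n i s) ρ)
         (rowCoeff-zero ty n r (nums≡0 n (<⇒≢ i<n ∘ sym)) (bars≡0 n) (cnt-shaded zer r shaded refl) s)
... | inj₂ refl = trans (Ψrow-top-value ty i r ρ) (cong (_* one (topRoot ty i) ρ) (coeff≡0 ty))
  where
  coeff≡0 : ∀ ty → topCoeff ty i r ≡ 0
  coeff≡0 B rewrite cnt-shaded zer r shaded refl | cnt-shaded (bar i) r shaded refl = refl
  coeff≡0 C = cnt-shaded (bar i) r shaded refl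

Ψ-singleRow : ∀ ty n j T ρ → 1 ≤ j → j ≤ n → UnshadedOnlyInRow n j T →
              Ψ ty n T ρ ≡ Ψrow ty n j (rowAt T j) ρ
Ψ-singleRow ty n j T ρ 1≤j j≤n shaded =
  sumK-pick (λ i → Ψrow ty n i (rowAt T i)) ρ (range-unique 1 (suc n)) (∈-range⁺ 1≤j (s≤s j≤n))
            other≡0
  where
  other≡0 : ∀ i → i ∈ range 1 (suc n) → i ≢ j → Ψrow ty n i (rowAt T i) ρ ≡ 0
  other≡0 i i∈ i≢j with 1≤i , s≤s i≤n ← ∈-range⁻ {1} {suc n} i∈ =
    Ψrow-shaded ty n i (rowAt T i) ρ i≤n (shaded i 1≤i i≤n i≢j)

-- The bracket word S_n of a Kostant partition supported on one row

weight : Ty → ℕ → ℕ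
weight B x = 2 * x
weight C x = x

weight-zero : ∀ ty → weight ty 0 ≡ 0
weight-zero B = refl
weight-zero C = refl

weight-mono-< : ∀ ty {x y} → x < y → weight ty x < weight ty y
weight-mono-< B x<y = *-monoʳ-< 2 x<y
weight-mono-< C x<y = x<y

weight-mono-≤ : ∀ ty {x y} → x ≤ y → weight ty x ≤ weight ty y
weight-mono-≤ B x≤y = *-monoʳ-≤ 2 x≤y
weight-mono-≤ C x≤y = x≤y

block : Ty → ℕ → Kp → ℕ → List (Br × Root)
block ty n c k = rep (c (R paired)) cl (R paired) ++ rep (weight ty (c (R surplusN))) op (R surplusN)
              ++ rep (weight ty (c (R surplusBar))) cl (R surplusBar) ++ rep (c (R paired)) op (R paired)
  where R = slotRoot ty n k

SnWord-blocks : ∀ ty n c →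
  SnWord ty n c ≡ concatMap (block ty n c) (range 1 n) ++ rep (c (topRoot ty n)) cl (topRoot ty n)
SnWord-blocks B n c = refl
SnWord-blocks C n c = refl

block-otherRow : ∀ ty n c {j} k → SupportedOnRow j c → k ≢ j → block ty n c k ≡ []
block-otherRow ty n c k supp k≢j
  rewrite supp (slotRoot ty n k paired) (k≢j ∘ trans (sym (slotRoot-row ty n k paired)))
        | supp (slotRoot ty n k surplusN) (k≢j ∘ trans (sym (slotRoot-row ty n k surplusN)))
        | supp (slotRoot ty n k surplusBar) (k≢j ∘ trans (sym (slotRoot-row ty n k surplusBar)))
        | weight-zero ty = refl

leftmostOpen-SnWord-row : ∀ ty n c j → SupportedOnRow j c → 1 ≤ j → j < n →
  leftmostOpen (SnWord ty n c) ≡ leftmostOpen (block ty n c j)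
leftmostOpen-SnWord-row ty n c j supp 1≤j j<n = cong leftmostOpen (begin
  SnWord ty n c
    ≡⟨ SnWord-blocks ty n c ⟩
  concatMap (block ty n c) (range 1 n) ++ rep (c (topRoot ty n)) cl (topRoot ty n)
    ≡⟨ cong₂ _++_ (concatMap-pick (block ty n c) (range-unique 1 n) (∈-range⁺ 1≤j j<n)
                                  λ k _ k≢j → block-otherRow ty n c k supp k≢j)
                  (cong (λ m → rep m cl (topRoot ty n)) (supp (topRoot ty n) top≢j)) ⟩
  block ty n c j ++ []
    ≡⟨ ++-identityʳ (block ty n c j) ⟩
  block ty n c j ∎)
  where
  open ≡-Reasoning
  top≢j : rowOf (topRoot ty n) ≢ j
  top≢j e = <⇒≢ j<n (trans (sym e) (topRoot-row ty n))

leftmostOpen-SnWord-top : ∀ ty n c → SupportedOnRow n c → leftmostOpen (SnWord ty n c) ≡ nothing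
leftmostOpen-SnWord-top ty n c supp = begin
  leftmostOpen (SnWord ty n c)
    ≡⟨ cong leftmostOpen (SnWord-blocks ty n c) ⟩
  leftmostOpen (concatMap (block ty n c) (range 1 n) ++ rep (c (topRoot ty n)) cl (topRoot ty n))
    ≡⟨ cong (λ w → leftmostOpen (w ++ rep (c (topRoot ty n)) cl (topRoot ty n))) blocks≡[] ⟩
  leftmostOpen (rep (c (topRoot ty n)) cl (topRoot ty n))
    ≡⟨ leftmostOpen-closers (c (topRoot ty n)) (topRoot ty n) ⟩
  nothing ∎
  where
  open ≡-Reasoning
  blocks≡[] : concatMap (block ty n c) (range 1 n) ≡ []
  blocks≡[] = concatMap-[] (block ty n c) (range 1 n) λ k k∈ →
                block-otherRow ty n c k supp (<⇒≢ (proj₂ (∈-range⁻ k∈)))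

fKp-noOpen : ∀ ty n c ρ → leftmostOpen (SnWord ty n c) ≡ nothing →
             fKp ty n c ρ ≡ c ρ + one (topRoot ty n) ρ
fKp-noOpen B n c ρ lo rewrite lo = refl
fKp-noOpen C n c ρ lo rewrite lo = refl

fKp-B-open-β-below : ∀ n′ c {j} ρ → leftmostOpen (SnWord B (suc n′) c) ≡ just (β j n′) →
                     fKp B (suc n′) c ρ ≡ c ρ ∸ 1 * one (β j n′) ρ + 1 * one (β j (suc n′)) ρ
fKp-B-open-β-below n′ c {j} ρ lo
  rewrite lo | ≢⇒≡ᵇ-false (<⇒≢ (n<1+n n′))
        | *-identityˡ (one (β j n′) ρ) | *-identityˡ (one (β j (suc n′)) ρ) = refl

fKp-B-open-β-top : ∀ n′ c {j} ρ → leftmostOpen (SnWord B (suc n′) c) ≡ just (β j (suc n′)) →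
                   fKp B (suc n′) c ρ ≡ c ρ ∸ 1 * one (β j (suc n′)) ρ + 1 * one (γ j (suc n′)) ρ
fKp-B-open-β-top n′ c {j} ρ lo
  rewrite lo | ≡ᵇ-refl n′
        | *-identityˡ (one (β j (suc n′)) ρ) | *-identityˡ (one (γ j (suc n′)) ρ) = refl

fKp-C-open-γ : ∀ n c {k l} ρ → leftmostOpen (SnWord C n c) ≡ just (γ k l) →
               fKp C n c ρ ≡ c ρ ∸ 1 * one (γ k l) ρ + 2 * one (γ k n) ρ
fKp-C-open-γ n c {k} {l} ρ lo rewrite lo | *-identityˡ (one (γ k l) ρ) = refl

fKp-C-open-β-last : ∀ n c {k l} ρ → leftmostOpen (SnWord C n c) ≡ just (β k l) →
                    c (γ k n) ≡ c (β k l) ∸ 1 →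
                    fKp C n c ρ ≡ c ρ ∸ 1 * one (β k l) ρ + 1 * one (γ k n) ρ
fKp-C-open-β-last n c {k} {l} ρ lo last
  rewrite lo | last | ≡ᵇ-refl (c (β k l) ∸ 1)
        | *-identityˡ (one (β k l) ρ) | *-identityˡ (one (γ k n) ρ) = refl

fKp-C-open-β-pair : ∀ n c {k l} ρ → leftmostOpen (SnWord C n c) ≡ just (β k l) →
                    suc (c (γ k n)) < c (β k l) →
                    fKp C n c ρ ≡ c ρ ∸ 2 * one (β k l) ρ + 1 * one (γ k k) ρ
fKp-C-open-β-pair n c {k} {l} ρ lo lt
  rewrite lo | ≢⇒≡ᵇ-false (<⇒≢ (∸-monoˡ-≤ 1 lt))
        | <⇒<ᵇ-true (∸-monoˡ-≤ {m = suc (suc (c (γ k n)))} 1 lt)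
        | *-identityˡ (one (γ k k) ρ) = refl

record Move (h h′ : Coeffs) (s t : Slot) (k l : ℕ) : Set where
  field
    distinct : s ≢ t
    source   : h s ≡ k + h′ s
    target   : h′ t ≡ h t + l
    others   : ∀ u → u ≢ s → u ≢ t → h′ u ≡ h u

onSlots-agree : ∀ R h h′ ρ → (∀ u → R u ≡ ρ → h u ≡ h′ u) → onSlots R h ρ ≡ onSlots R h′ ρ
onSlots-agree R h h′ ρ agree = cong₂ _+_ (cong₂ _+_ (term paired) (term surplusN)) (term surplusBar)
  where
  term : ∀ u → h u * one (R u) ρ ≡ h′ u * one (R u) ρ
  term u with R u ≟ᴿ ρ
  ... | yes Ru≡ρ = cong (_* one (R u) ρ) (agree u Ru≡ρ)
  ... | no  Ru≢ρ rewrite one-≢ (R u) ρ Ru≢ρ | *-zeroʳ (h u) | *-zeroʳ (h′ u) = refl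

moved-cong : ∀ k l {x x′ a a′ b b′} → x ≡ x′ → a ≡ a′ → b ≡ b′ →
             x ∸ k * a + l * b ≡ x′ ∸ k * a′ + l * b′
moved-cong k l refl refl refl = refl

module _ {R : Slot → Root} (inj : Injective _≡_ _≡_ R) (G : Kp) {h h′ s t k l} (mv : Move h h′ s t k l)
  where
  open Move mv
  open ≡-Reasoning

  transfer-source : G (R s) + onSlots R h (R s) ∸ k * one (R s) (R s) + l * one (R t) (R s)
                  ≡ G (R s) + onSlots R h′ (R s)
  transfer-source = begin
    G (R s) + onSlots R h (R s) ∸ k * one (R s) (R s) + l * one (R t) (R s)
      ≡⟨ moved-cong k l (cong (G (R s) +_) (onSlots-at inj h s)) (one-same (R s))
                    (one-apart inj t s (distinct ∘ sym)) ⟩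
    G (R s) + h s ∸ k * 1 + l * 0
      ≡⟨ cong₂ (λ a b → G (R s) + a ∸ b + l * 0) source (*-identityʳ k) ⟩
    G (R s) + (k + h′ s) ∸ k + l * 0
      ≡⟨ cong₂ _+_ (cong (_∸ k) (x+[y+z]≡y+[x+z] (G (R s)) k (h′ s))) (*-zeroʳ l) ⟩
    k + (G (R s) + h′ s) ∸ k + 0
      ≡⟨ trans (+-identityʳ _) (m+n∸m≡n k _) ⟩
    G (R s) + h′ s
      ≡⟨ cong (G (R s) +_) (onSlots-at inj h′ s) ⟨
    G (R s) + onSlots R h′ (R s) ∎
    where
    x+[y+z]≡y+[x+z] : ∀ x y z → x + (y + z) ≡ y + (x + z)
    x+[y+z]≡y+[x+z] x y z = trans (sym (+-assoc x y z)) (trans (cong (_+ z) (+-comm x y)) (+-assoc y x z))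

  transfer-target : G (R t) + onSlots R h (R t) ∸ k * one (R s) (R t) + l * one (R t) (R t)
                  ≡ G (R t) + onSlots R h′ (R t)
  transfer-target = begin
    G (R t) + onSlots R h (R t) ∸ k * one (R s) (R t) + l * one (R t) (R t)
      ≡⟨ moved-cong k l (cong (G (R t) +_) (onSlots-at inj h t)) (one-apart inj s t distinct) (one-same (R t)) ⟩
    G (R t) + h t ∸ k * 0 + l * 1
      ≡⟨ cong₂ (λ a b → G (R t) + h t ∸ a + b) (*-zeroʳ k) (*-identityʳ l) ⟩
    G (R t) + h t + l
      ≡⟨ +-assoc (G (R t)) (h t) l ⟩
    G (R t) + (h t + l)
      ≡⟨ cong (G (R t) +_) (trans (sym target) (sym (onSlots-at inj h′ t))) ⟩
    G (R t) + onSlots R h′ (R t) ∎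

  transfer-elsewhere : ∀ ρ → ρ ≢ R s → ρ ≢ R t →
                       G ρ + onSlots R h ρ ∸ k * one (R s) ρ + l * one (R t) ρ ≡ G ρ + onSlots R h′ ρ
  transfer-elsewhere ρ ρ≢Rs ρ≢Rt = begin
    G ρ + onSlots R h ρ ∸ k * one (R s) ρ + l * one (R t) ρ
      ≡⟨ moved-cong k l refl (one-≢ (R s) ρ (ρ≢Rs ∘ sym)) (one-≢ (R t) ρ (ρ≢Rt ∘ sym)) ⟩
    G ρ + onSlots R h ρ ∸ k * 0 + l * 0
      ≡⟨ cong₂ (λ a b → G ρ + onSlots R h ρ ∸ a + b) (*-zeroʳ k) (*-zeroʳ l) ⟩
    G ρ + onSlots R h ρ + 0
      ≡⟨ +-identityʳ _ ⟩
    G ρ + onSlots R h ρ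
      ≡⟨ cong (G ρ +_) (onSlots-agree R h h′ ρ unmoved) ⟩
    G ρ + onSlots R h′ ρ ∎
    where
    unmoved : ∀ u → R u ≡ ρ → h u ≡ h′ u
    unmoved u Ru≡ρ = sym (others u (λ { refl → ρ≢Rs (sym Ru≡ρ) }) (λ { refl → ρ≢Rt (sym Ru≡ρ) }))

  transfer : ∀ ρ → G ρ + onSlots R h ρ ∸ k * one (R s) ρ + l * one (R t) ρ ≡ G ρ + onSlots R h′ ρ
  transfer ρ with ρ ≟ᴿ R s | ρ ≟ᴿ R t
  ... | yes refl | _        = transfer-source
  ... | no _     | yes refl = transfer-target
  ... | no ρ≢Rs  | no ρ≢Rt  = transfer-elsewhere ρ ρ≢Rs ρ≢Rt

-- One constructor for each clause of f_n on Kostant partitions: the inequality is what makes the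
-- leftmost '(' of S_n carry the label of the source slot.
data SlotStep : Ty → Coeffs → Coeffs → Set where
  B-surplusN→paired     : ∀ {h h′} → h surplusBar < h surplusN →
                          Move h h′ surplusN paired 1 1 → SlotStep B h h′
  B-paired→surplusBar   : ∀ {h h′} → h surplusN ≤ h surplusBar →
                          Move h h′ paired surplusBar 1 1 → SlotStep B h h′
  C-surplusN→surplusBar : ∀ {h h′} → h surplusN ≡ suc (h surplusBar) →
                          Move h h′ surplusN surplusBar 1 1 → SlotStep C h h′
  C-surplusN→paired     : ∀ {h h′} → suc (h surplusBar) < h surplusN →
                          Move h h′ surplusN paired 2 1 → SlotStep C h h′
  C-paired→surplusBar   : ∀ {h h′} → h surplusN ≤ h surplusBar →
                          Move h h′ paired surplusBar 1 2 → SlotStep C h h′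

index₂ : Root → ℕ
index₂ (β _ k) = k
index₂ (γ _ k) = k

slotRoot-injective : ∀ ty n′ j → j < suc n′ → Injective _≡_ _≡_ (slotRoot ty (suc n′) j)
slotRoot-injective ty n′ j j<n {paired}     {paired}     _ = refl
slotRoot-injective ty n′ j j<n {surplusN}   {surplusN}   _ = refl
slotRoot-injective ty n′ j j<n {surplusBar} {surplusBar} _ = refl
slotRoot-injective ty n′ j j<n {surplusN}   {surplusBar} ()
slotRoot-injective ty n′ j j<n {surplusBar} {surplusN}   ()
slotRoot-injective B  n′ j j<n {paired}     {surplusN}   e = contradiction (cong index₂ e) 1+n≢n
slotRoot-injective B  n′ j j<n {surplusN}   {paired}     e = contradiction (cong index₂ (sym e)) 1+n≢n
slotRoot-injective C  n′ j j<n {paired}     {surplusBar} e = contradiction (cong index₂ e) (<⇒≢ j<n)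
slotRoot-injective C  n′ j j<n {surplusBar} {paired}     e = contradiction (cong index₂ (sym e)) (<⇒≢ j<n)

module SlotDecomposition (ty : Ty) (n′ j : ℕ) (1≤j : 1 ≤ j) (j<n : j < suc n′) (c G : Kp) (h : Coeffs)
  (supp : SupportedOnRow j c) (c≡ : ∀ ρ → c ρ ≡ G ρ + onSlots (slotRoot ty (suc n′) j) h ρ)
  (G-paired : G (slotRoot ty (suc n′) j paired) ≡ 0) (G-surplus : G (β j n′) ≡ G (γ j (suc n′))) where

  R : Slot → Root
  R = slotRoot ty (suc n′) j

  X : ℕ
  X = G (β j n′)

  inj : Injective _≡_ _≡_ R
  inj = slotRoot-injective ty n′ j j<n

  c-paired : c (R paired) ≡ h paired
  c-paired = trans (c≡ (R paired)) (cong₂ _+_ G-paired (onSlots-at inj h paired))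

  c-surplusN : c (R surplusN) ≡ X + h surplusN
  c-surplusN = trans (c≡ (R surplusN)) (cong (X +_) (onSlots-at inj h surplusN))

  c-surplusBar : c (R surplusBar) ≡ X + h surplusBar
  c-surplusBar = trans (c≡ (R surplusBar)) (cong₂ _+_ (sym G-surplus) (onSlots-at inj h surplusBar))

  V W : ℕ
  V = weight ty (c (R surplusN))
  W = weight ty (c (R surplusBar))

  leftmostOpen-SnWord : leftmostOpen (SnWord ty (suc n′) c)
                          ≡ lastM (replicate (c (R paired)) (R paired) ++ replicate (V ∸ W) (R surplusN))
  leftmostOpen-SnWord = trans (leftmostOpen-SnWord-row ty (suc n′) c j supp 1≤j j<n)
                              (leftmostOpen-block (c (R paired)) V W (R paired) (R surplusN) (R surplusBar))

  opens-surplusN : h surplusBar < h surplusN → leftmostOpen (SnWord ty (suc n′) c) ≡ just (R surplusN)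
  opens-surplusN lt =
    trans leftmostOpen-SnWord (lastM-surplus (c (R paired)) V W (R paired) (R surplusN) (weight-mono-< ty c₃<c₂))
    where
    c₃<c₂ : c (R surplusBar) < c (R surplusN)
    c₃<c₂ = subst₂ _<_ (sym c-surplusBar) (sym c-surplusN) (+-monoʳ-< X lt)

  opens-paired : h surplusN ≤ h surplusBar → 0 < h paired →
                 leftmostOpen (SnWord ty (suc n′) c) ≡ just (R paired)
  opens-paired le pos =
    trans leftmostOpen-SnWord
          (lastM-balanced (c (R paired)) V W (R paired) (R surplusN) (weight-mono-≤ ty c₂≤c₃) c₁>0)
    where
    c₂≤c₃ : c (R surplusN) ≤ c (R surplusBar)
    c₂≤c₃ = subst₂ _≤_ (sym c-surplusN) (sym c-surplusBar) (+-monoʳ-≤ X le)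
    c₁>0 : 0 < c (R paired)
    c₁>0 = subst (0 <_) (sym c-paired) pos

  source-positive : ∀ {h′ s t k l} → Move h h′ s t (suc k) l → 0 < h s
  source-positive mv = subst (0 <_) (sym (Move.source mv)) (s≤s z≤n)

  moved : ∀ {h′ s t k l} → Move h h′ s t k l → ∀ ρ →
          c ρ ∸ k * one (R s) ρ + l * one (R t) ρ ≡ G ρ + onSlots R h′ ρ
  moved {k = k} {l} mv ρ = trans (cong (λ x → x ∸ k * _ + l * _) (c≡ ρ)) (transfer inj G mv ρ)

  fKp-slotStep : ∀ {h′} → SlotStep ty h h′ → ∀ ρ → fKp ty (suc n′) c ρ ≡ G ρ + onSlots R h′ ρ
  fKp-slotStep (B-surplusN→paired lt mv) ρ =
    trans (fKp-B-open-β-below n′ c ρ (opens-surplusN lt)) (moved mv ρ)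
  fKp-slotStep (B-paired→surplusBar le mv) ρ =
    trans (fKp-B-open-β-top n′ c ρ (opens-paired le (source-positive mv))) (moved mv ρ)
  fKp-slotStep (C-surplusN→surplusBar eq mv) ρ =
    trans (fKp-C-open-β-last (suc n′) c ρ (opens-surplusN (≤-reflexive (sym eq))) last) (moved mv ρ)
    where
    last : c (R surplusBar) ≡ c (R surplusN) ∸ 1
    last = trans c-surplusBar (sym (cong (_∸ 1) (trans c-surplusN (trans (cong (X +_) eq) (+-suc X _)))))
  fKp-slotStep (C-surplusN→paired lt mv) ρ =
    trans (fKp-C-open-β-pair (suc n′) c ρ (opens-surplusN (<-trans (n<1+n _) lt)) gap) (moved mv ρ)
    where
    gap : suc (c (R surplusBar)) < c (R surplusN)
    gap = subst₂ (λ x y → suc x < y) (sym c-surplusBar) (sym c-surplusN)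
                 (subst (_< X + h surplusN) (+-suc X _) (+-monoʳ-< X lt))
  fKp-slotStep (C-paired→surplusBar le mv) ρ =
    trans (fKp-C-open-γ (suc n′) c ρ (opens-paired le (source-positive mv))) (moved mv ρ)

-- Changing one letter n, 0 or n̄

move-surplusN→paired : ∀ {h h′ k l} → h surplusN ≡ k + h′ surplusN → h′ paired ≡ h paired + l →
                       h′ surplusBar ≡ h surplusBar → Move h h′ surplusN paired k l
move-surplusN→paired src tgt idle = record
  { distinct = λ () ; source = src ; target = tgt
  ; others   = λ { surplusBar _ _ → idle
               ; surplusN ≢s _ → contradiction refl ≢s
               ; paired _ ≢t → contradiction refl ≢t } }

move-paired→surplusBar : ∀ {h h′ k l} → h paired ≡ k + h′ paired →
                         h′ surplusBar ≡ h surplusBar + l →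
                         h′ surplusN ≡ h surplusN → Move h h′ paired surplusBar k l
move-paired→surplusBar src tgt idle = record
  { distinct = λ () ; source = src ; target = tgt
  ; others   = λ { surplusN _ _ → idle
               ; paired ≢s _ → contradiction refl ≢s
               ; surplusBar _ ≢t → contradiction refl ≢t } }

move-surplusN→surplusBar : ∀ {h h′ k l} → h surplusN ≡ k + h′ surplusN →
                           h′ surplusBar ≡ h surplusBar + l →
                           h′ paired ≡ h paired → Move h h′ surplusN surplusBar k l
move-surplusN→surplusBar src tgt idle = record
  { distinct = λ () ; source = src ; target = tgt
  ; others   = λ { paired _ _ → idle
               ; surplusN ≢s _ → contradiction refl ≢s
               ; surplusBar _ ≢t → contradiction refl ≢t } }

1+n≡n+1 : ∀ m → suc m ≡ m + 1
1+n≡n+1 m = +-comm 1 m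

slotStep-n↦0-surplusN : ∀ {a b} z → b ≤ a → SlotStep B (slotCoeff B (suc a) b z) (slotCoeff B a b (suc z))
slotStep-n↦0-surplusN {a} {b} z b≤a = B-surplusN→paired lt (move-surplusN→paired src tgt idle)
  where
  ⊓₁ : suc a ⊓ b ≡ b
  ⊓₁ = m≥n⇒m⊓n≡n (m≤n⇒m≤1+n b≤a)
  ⊓₀ : a ⊓ b ≡ b
  ⊓₀ = m≥n⇒m⊓n≡n b≤a
  lt : b ∸ suc a ⊓ b < suc a ∸ suc a ⊓ b
  lt rewrite ⊓₁ | n∸n≡0 b = m<n⇒0<n∸m (s≤s b≤a)
  src : suc a ∸ suc a ⊓ b ≡ 1 + (a ∸ a ⊓ b)
  src rewrite ⊓₁ | ⊓₀ = +-∸-assoc 1 b≤a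
  tgt : 2 * (a ⊓ b) + suc z ≡ 2 * (suc a ⊓ b) + z + 1
  tgt rewrite ⊓₁ | ⊓₀ = trans (+-suc (2 * b) z) (1+n≡n+1 (2 * b + z))
  idle : b ∸ a ⊓ b ≡ b ∸ suc a ⊓ b
  idle rewrite ⊓₁ | ⊓₀ = refl

slotStep-n↦0-surplusBar : ∀ {a b} z → a < b → SlotStep B (slotCoeff B (suc a) b z) (slotCoeff B a b (suc z))
slotStep-n↦0-surplusBar {a} {b} z a<b = B-paired→surplusBar le (move-paired→surplusBar src tgt idle)
  where
  ⊓₁ : suc a ⊓ b ≡ suc a
  ⊓₁ = m≤n⇒m⊓n≡m a<b
  ⊓₀ : a ⊓ b ≡ a
  ⊓₀ = m≤n⇒m⊓n≡m (<⇒≤ a<b)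
  le : suc a ∸ suc a ⊓ b ≤ b ∸ suc a ⊓ b
  le rewrite ⊓₁ | n∸n≡0 a = z≤n
  src : 2 * (suc a ⊓ b) + z ≡ 1 + (2 * (a ⊓ b) + suc z)
  src rewrite ⊓₁ | ⊓₀ = doubled a z
    where doubled : ∀ a z → 2 * suc a + z ≡ 1 + (2 * a + suc z)
          doubled = solve-∀
  tgt : b ∸ a ⊓ b ≡ b ∸ suc a ⊓ b + 1
  tgt rewrite ⊓₁ | ⊓₀ = trans (+-∸-assoc 1 a<b) (1+n≡n+1 _)
  idle : a ∸ a ⊓ b ≡ suc a ∸ suc a ⊓ b
  idle rewrite ⊓₁ | ⊓₀ | n∸n≡0 a = refl

slotStep-n↦0 : ∀ a b z → SlotStep B (slotCoeff B (suc a) b z) (slotCoeff B a b (suc z))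
slotStep-n↦0 a b z with b ≤? a
... | yes b≤a = slotStep-n↦0-surplusN z b≤a
... | no  b≰a = slotStep-n↦0-surplusBar z (≰⇒> b≰a)

slotStep-0↦n̄-surplusN : ∀ {a b} z → b < a → SlotStep B (slotCoeff B a b (suc z)) (slotCoeff B a (suc b) z)
slotStep-0↦n̄-surplusN {a} {b} z b<a = B-surplusN→paired lt (move-surplusN→paired src tgt idle)
  where
  ⊓₀ : a ⊓ b ≡ b
  ⊓₀ = m≥n⇒m⊓n≡n (<⇒≤ b<a)
  ⊓₁ : a ⊓ suc b ≡ suc b
  ⊓₁ = m≥n⇒m⊓n≡n b<a
  lt : b ∸ a ⊓ b < a ∸ a ⊓ b
  lt rewrite ⊓₀ | n∸n≡0 b = m<n⇒0<n∸m b<a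
  src : a ∸ a ⊓ b ≡ 1 + (a ∸ a ⊓ suc b)
  src rewrite ⊓₀ | ⊓₁ = +-∸-assoc 1 b<a
  tgt : 2 * (a ⊓ suc b) + z ≡ 2 * (a ⊓ b) + suc z + 1
  tgt rewrite ⊓₀ | ⊓₁ = shifted b z
    where shifted : ∀ b z → 2 * suc b + z ≡ 2 * b + suc z + 1
          shifted = solve-∀
  idle : suc b ∸ a ⊓ suc b ≡ b ∸ a ⊓ b
  idle rewrite ⊓₀ | ⊓₁ | n∸n≡0 b = refl

slotStep-0↦n̄-surplusBar : ∀ {a b} z → a ≤ b → SlotStep B (slotCoeff B a b (suc z)) (slotCoeff B a (suc b) z)
slotStep-0↦n̄-surplusBar {a} {b} z a≤b = B-paired→surplusBar le (move-paired→surplusBar src tgt idle)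
  where
  ⊓₀ : a ⊓ b ≡ a
  ⊓₀ = m≤n⇒m⊓n≡m a≤b
  ⊓₁ : a ⊓ suc b ≡ a
  ⊓₁ = m≤n⇒m⊓n≡m (m≤n⇒m≤1+n a≤b)
  le : a ∸ a ⊓ b ≤ b ∸ a ⊓ b
  le rewrite ⊓₀ | n∸n≡0 a = z≤n
  src : 2 * (a ⊓ b) + suc z ≡ 1 + (2 * (a ⊓ suc b) + z)
  src rewrite ⊓₀ | ⊓₁ = +-suc (2 * a) z
  tgt : suc b ∸ a ⊓ suc b ≡ b ∸ a ⊓ b + 1
  tgt rewrite ⊓₀ | ⊓₁ = trans (+-∸-assoc 1 a≤b) (1+n≡n+1 _)
  idle : a ∸ a ⊓ suc b ≡ a ∸ a ⊓ b
  idle rewrite ⊓₀ | ⊓₁ = refl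

slotStep-0↦n̄ : ∀ a b z → SlotStep B (slotCoeff B a b (suc z)) (slotCoeff B a (suc b) z)
slotStep-0↦n̄ a b z with b <? a
... | yes b<a = slotStep-0↦n̄-surplusN z b<a
... | no  b≮a = slotStep-0↦n̄-surplusBar z (≮⇒≥ b≮a)

slotStep-n↦n̄-balanced : ∀ a z → SlotStep C (slotCoeff C (suc a) a z) (slotCoeff C a (suc a) z)
slotStep-n↦n̄-balanced a z = C-surplusN→surplusBar eq (move-surplusN→surplusBar src tgt idle)
  where
  ⊓₁ : suc a ⊓ a ≡ a
  ⊓₁ = m≥n⇒m⊓n≡n (n≤1+n a)
  ⊓₁′ : a ⊓ suc a ≡ a
  ⊓₁′ = m≤n⇒m⊓n≡m (n≤1+n a)
  eq : suc a ∸ suc a ⊓ a ≡ suc (a ∸ suc a ⊓ a)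
  eq rewrite ⊓₁ = +-∸-assoc 1 (≤-refl {a})
  src : suc a ∸ suc a ⊓ a ≡ 1 + (a ∸ a ⊓ suc a)
  src rewrite ⊓₁ | ⊓₁′ = +-∸-assoc 1 (≤-refl {a})
  tgt : suc a ∸ a ⊓ suc a ≡ a ∸ suc a ⊓ a + 1
  tgt rewrite ⊓₁ | ⊓₁′ = trans (+-∸-assoc 1 (≤-refl {a})) (1+n≡n+1 _)
  idle : a ⊓ suc a ≡ suc a ⊓ a
  idle = trans ⊓₁′ (sym ⊓₁)

slotStep-n↦n̄-surplusN : ∀ {a b} z → b < a → SlotStep C (slotCoeff C (suc a) b z) (slotCoeff C a (suc b) z)
slotStep-n↦n̄-surplusN {a} {b} z b<a = C-surplusN→paired lt (move-surplusN→paired src tgt idle)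
  where
  ⊓₁ : suc a ⊓ b ≡ b
  ⊓₁ = m≥n⇒m⊓n≡n (m≤n⇒m≤1+n (<⇒≤ b<a))
  ⊓₁′ : a ⊓ suc b ≡ suc b
  ⊓₁′ = m≥n⇒m⊓n≡n b<a
  src : suc a ∸ suc a ⊓ b ≡ 2 + (a ∸ a ⊓ suc b)
  src rewrite ⊓₁ | ⊓₁′ = trans (+-∸-assoc 1 (<⇒≤ b<a)) (cong suc (+-∸-assoc 1 b<a))
  lt : suc (b ∸ suc a ⊓ b) < suc a ∸ suc a ⊓ b
  lt rewrite ⊓₁ | n∸n≡0 b | +-∸-assoc 1 (<⇒≤ b<a) | +-∸-assoc 1 b<a = s≤s (s≤s z≤n)
  tgt : a ⊓ suc b ≡ suc a ⊓ b + 1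
  tgt rewrite ⊓₁ | ⊓₁′ = 1+n≡n+1 b
  idle : suc b ∸ a ⊓ suc b ≡ b ∸ suc a ⊓ b
  idle rewrite ⊓₁ | ⊓₁′ | n∸n≡0 b = refl

slotStep-n↦n̄-surplusBar : ∀ {a b} z → a < b → SlotStep C (slotCoeff C (suc a) b z) (slotCoeff C a (suc b) z)
slotStep-n↦n̄-surplusBar {a} {b} z a<b = C-paired→surplusBar le (move-paired→surplusBar src tgt idle)
  where
  ⊓₁ : suc a ⊓ b ≡ suc a
  ⊓₁ = m≤n⇒m⊓n≡m a<b
  ⊓₁′ : a ⊓ suc b ≡ a
  ⊓₁′ = m≤n⇒m⊓n≡m (m≤n⇒m≤1+n (<⇒≤ a<b))
  le : suc a ∸ suc a ⊓ b ≤ b ∸ suc a ⊓ b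
  le rewrite ⊓₁ | n∸n≡0 a = z≤n
  src : suc a ⊓ b ≡ 1 + a ⊓ suc b
  src rewrite ⊓₁ | ⊓₁′ = refl
  tgt : suc b ∸ a ⊓ suc b ≡ b ∸ suc a ⊓ b + 2
  tgt rewrite ⊓₁ | ⊓₁′ =
    trans (+-∸-assoc 1 (<⇒≤ a<b)) (trans (cong suc (+-∸-assoc 1 a<b)) (+-comm 2 _))
  idle : a ∸ a ⊓ suc b ≡ suc a ∸ suc a ⊓ b
  idle rewrite ⊓₁ | ⊓₁′ | n∸n≡0 a = refl

slotStep-n↦n̄ : ∀ a b z → SlotStep C (slotCoeff C (suc a) b z) (slotCoeff C a (suc b) z)
slotStep-n↦n̄ a b z with <-cmp a b
... | tri≈ _ refl _ = slotStep-n↦n̄-balanced a z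
... | tri> _ _ b<a = slotStep-n↦n̄-surplusN z b<a
... | tri< a<b _ _ = slotStep-n↦n̄-surplusBar z a<b

slotStep-row : ∀ {ty n e e′ r r′} → LetterStep ty n e e′ → Replaces e e′ r r′ →
  SlotStep ty (slotCoeff ty (cnt (num n) r) (cnt (bar n) r) (cnt zer r))
              (slotCoeff ty (cnt (num n) r′) (cnt (bar n) r′) (cnt zer r′))
slotStep-row {n = n} n↦0 replaces
  rewrite Replaces-removed replaces (num n) (≡ᵇ-refl n) refl | Replaces-untouched replaces (bar n) refl refl
        | Replaces-added replaces zer refl refl = slotStep-n↦0 _ _ _
slotStep-row {n = n} 0↦n̄ replaces
  rewrite Replaces-untouched replaces (num n) refl refl | Replaces-removed replaces zer refl refl
        | Replaces-added replaces (bar n) refl (≡ᵇ-refl n) = slotStep-0↦n̄ _ _ _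
slotStep-row {n = n} n↦n̄ replaces
  rewrite Replaces-removed replaces (num n) (≡ᵇ-refl n) refl
        | Replaces-added replaces (bar n) refl (≡ᵇ-refl n)
        | Replaces-untouched replaces zer refl refl = slotStep-n↦n̄ _ _ _

counts-below-n : ∀ {ty n e e′ r r′} → LetterStep ty n e e′ → Replaces e e′ r r′ →
  ∀ k → k < n → nums r′ k ≡ nums r k × bars r′ k ≡ bars r k
counts-below-n n↦0 replaces k k<n =
  Replaces-untouched replaces (num k) (≢⇒≡ᵇ-false (<⇒≢ k<n)) refl
  , Replaces-untouched replaces (bar k) refl refl
counts-below-n 0↦n̄ replaces k k<n =
  Replaces-untouched replaces (num k) refl refl
  , Replaces-untouched replaces (bar k) refl (≢⇒≡ᵇ-false (<⇒≢ k<n))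
counts-below-n n↦n̄ replaces k k<n =
  Replaces-untouched replaces (num k) (≢⇒≡ᵇ-false (<⇒≢ k<n)) refl
  , Replaces-untouched replaces (bar k) refl (≢⇒≡ᵇ-false (<⇒≢ k<n))

fKp-Ψrow-low : ∀ ty n′ j → 1 ≤ j → j < suc n′ → ∀ {e e′ r r′} →
  LetterStep ty (suc n′) e e′ → Replaces e e′ r r′ →
  (c : Kp) → (∀ ρ → c ρ ≡ Ψrow ty (suc n′) j r ρ) →
  ∀ ρ → fKp ty (suc n′) c ρ ≡ Ψrow ty (suc n′) j r′ ρ
fKp-Ψrow-low ty n′ j 1≤j j<n {r = r} {r′} step replaces c c≡ ρ = begin
  fKp ty n c ρ
    ≡⟨ SlotDecomposition.fKp-slotStep ty n′ j 1≤j j<n c (ΨrowRest n j r) (rowCoeff ty n r) supp c≡split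
                                      (ΨrowRest-paired≡0 ty n j r j<n) (ΨrowRest-surplusN≡surplusBar n′ j r)
                                      (slotStep-row step replaces) ρ ⟩
  ΨrowRest n j r ρ + onSlots (slotRoot ty n j) (rowCoeff ty n r′) ρ
    ≡⟨ cong (_+ onSlots (slotRoot ty n j) (rowCoeff ty n r′) ρ) rest≡ ⟨
  ΨrowRest n j r′ ρ + onSlots (slotRoot ty n j) (rowCoeff ty n r′) ρ
    ≡⟨ Ψrow-split ty n j r′ ρ j<n ⟨
  Ψrow ty n j r′ ρ ∎
  where
  open ≡-Reasoning
  n = suc n′
  supp : SupportedOnRow j c
  supp ρ′ ρ′∉j = trans (c≡ ρ′) (Ψrow-supported ty n j r (<⇒≤ j<n) ρ′ ρ′∉j)
  c≡split : ∀ ρ′ → c ρ′ ≡ ΨrowRest n j r ρ′ + onSlots (slotRoot ty n j) (rowCoeff ty n r) ρ′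
  c≡split ρ′ = trans (c≡ ρ′) (Ψrow-split ty n j r ρ′ j<n)
  rest≡ : ΨrowRest n j r′ ρ ≡ ΨrowRest n j r ρ
  rest≡ = ΨrowRest-cong n j r r′ ρ j<n (λ k _ k<n → proj₁ (counts-below-n step replaces k k<n))
                                       (λ k _ k<n → proj₂ (counts-below-n step replaces k k<n))

topCoeff-step : ∀ {ty n e e′ r r′} → LetterStep ty n e e′ → Replaces e e′ r r′ →
                topCoeff ty n r′ ≡ suc (topCoeff ty n r)
topCoeff-step {n = n} n↦0 replaces
  rewrite Replaces-added replaces zer refl refl | Replaces-untouched replaces (bar n) refl refl = refl
topCoeff-step {n = n} {r = r} {r′} 0↦n̄ replaces
  rewrite Replaces-removed replaces zer refl refl | Replaces-added replaces (bar n) refl (≡ᵇ-refl n) =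
  shift (cnt zer r′) (bars r n)
  where shift : ∀ z b → z + 2 * suc b ≡ suc (suc z + 2 * b)
        shift = solve-∀
topCoeff-step {n = n} n↦n̄ replaces = Replaces-added replaces (bar n) refl (≡ᵇ-refl n)

topCoeff-insert-n : ∀ ty n r p → topCoeff ty n (insertAt r p (num n)) ≡ topCoeff ty n r
topCoeff-insert-n B n r p rewrite cnt-insertAt zer r p (num n) | cnt-insertAt (bar n) r p (num n)
  = cong₂ _+_ (+-identityʳ (cnt zer r)) (cong (2 *_) (+-identityʳ (bars r n)))
topCoeff-insert-n C n r p = trans (cnt-insertAt (bar n) r p (num n)) (+-identityʳ _)

fKp-Ψrow-top : ∀ ty n {e e′ r r′} → LetterStep ty n e e′ → Replaces e e′ r r′ →
  (c : Kp) → (∀ ρ → c ρ ≡ Ψrow ty n n r ρ) → ∀ ρ → fKp ty n c ρ ≡ Ψrow ty n n r′ ρ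
fKp-Ψrow-top ty n {r = r} {r′} step replaces c c≡ ρ = begin
  fKp ty n c ρ                       ≡⟨ fKp-noOpen ty n c ρ (leftmostOpen-SnWord-top ty n c supp) ⟩
  c ρ + o                            ≡⟨ cong (_+ o) (trans (c≡ ρ) (Ψrow-top-value ty n r ρ)) ⟩
  topCoeff ty n r * o + o            ≡⟨ +-comm (topCoeff ty n r * o) o ⟩
  suc (topCoeff ty n r) * o          ≡⟨ cong (_* o) (topCoeff-step step replaces) ⟨
  topCoeff ty n r′ * o               ≡⟨ Ψrow-top-value ty n r′ ρ ⟨
  Ψrow ty n n r′ ρ                   ∎
  where
  open ≡-Reasoning
  o = one (topRoot ty n) ρ
  supp : SupportedOnRow n c
  supp ρ′ ρ′∉n = trans (c≡ ρ′) (Ψrow-supported ty n n r ≤-refl ρ′ ρ′∉n)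

fKp-Ψrow : ∀ ty n′ j → 1 ≤ j → j ≤ suc n′ → ∀ {e e′ r r′} →
  LetterStep ty (suc n′) e e′ → Replaces e e′ r r′ →
  (c : Kp) → (∀ ρ → c ρ ≡ Ψrow ty (suc n′) j r ρ) →
  ∀ ρ → fKp ty (suc n′) c ρ ≡ Ψrow ty (suc n′) j r′ ρ
fKp-Ψrow ty n′ j 1≤j j≤n step with m≤n⇒m<n∨m≡n j≤n
... | inj₁ j<n  = fKp-Ψrow-low ty n′ j 1≤j j<n step
... | inj₂ refl = fKp-Ψrow-top ty j step

UnshadedOnlyInRow-modifyRow : ∀ {n j T} f → UnshadedOnlyInRow n j T → UnshadedOnlyInRow n j (modifyRow T j f)
UnshadedOnlyInRow-modifyRow {j = j} {T} f shaded i 1≤i i≤n i≢j =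
  subst (All (_≡ num i)) (sym (rowAt-modifyRow-other T j i f i≢j)) (shaded i 1≤i i≤n i≢j)

UnshadedOnlyInRow-insertColumn : ∀ {n j T} p → length T ≡ n → UnshadedOnlyInRow n j T →
                                 UnshadedOnlyInRow n j (insertColumn T p)
UnshadedOnlyInRow-insertColumn {T = T} p lenT shaded i 1≤i i≤n i≢j =
  subst (All (_≡ num i)) (sym (rowAt-insertColumn T p i 1≤i (subst (i ≤_) (sym lenT) i≤n)))
        (All-insertAt (rowAt T i) p (shaded i 1≤i i≤n i≢j) refl)

Ψ-modifyRow : ∀ ty n j T f ρ → 1 ≤ j → j ≤ n → length T ≡ n → UnshadedOnlyInRow n j T →
              Ψ ty n (modifyRow T j f) ρ ≡ Ψrow ty n j (f (rowAt T j)) ρ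
Ψ-modifyRow ty n j T f ρ 1≤j j≤n lenT shaded =
  trans (Ψ-singleRow ty n j (modifyRow T j f) ρ 1≤j j≤n (UnshadedOnlyInRow-modifyRow f shaded))
        (cong (λ r → Ψrow ty n j r ρ) (rowAt-modifyRow-same T j f 1≤j (subst (j ≤_) (sym lenT) j≤n)))

Ψrow-top-insert-n : ∀ ty n r p ρ → Ψrow ty n n (insertAt r p (num n)) ρ ≡ Ψrow ty n n r ρ
Ψrow-top-insert-n ty n r p ρ =
  trans (Ψrow-top-value ty n (insertAt r p (num n)) ρ)
        (trans (cong (_* one (topRoot ty n) ρ) (topCoeff-insert-n ty n r p)) (sym (Ψrow-top-value ty n r ρ)))

Ψ-insertColumn-top : ∀ ty n T p ρ → 1 ≤ n → length T ≡ n → UnshadedOnlyInRow n n T →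
                     Ψ ty n (insertColumn T p) ρ ≡ Ψ ty n T ρ
Ψ-insertColumn-top ty n T p ρ 1≤n lenT shaded = begin
  Ψ ty n (insertColumn T p) ρ
    ≡⟨ Ψ-singleRow ty n n (insertColumn T p) ρ 1≤n ≤-refl shadedᶜ ⟩
  Ψrow ty n n (rowAt (insertColumn T p) n) ρ      ≡⟨ cong (λ r → Ψrow ty n n r ρ) rowᶜ ⟩
  Ψrow ty n n (insertAt (rowAt T n) p (num n)) ρ  ≡⟨ Ψrow-top-insert-n ty n (rowAt T n) p ρ ⟩
  Ψrow ty n n (rowAt T n) ρ                       ≡⟨ Ψ-singleRow ty n n T ρ 1≤n ≤-refl shaded ⟨
  Ψ ty n T ρ                                      ∎
  where
  open ≡-Reasoning
  shadedᶜ : UnshadedOnlyInRow n n (insertColumn T p)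
  shadedᶜ = UnshadedOnlyInRow-insertColumn p lenT shaded
  rowᶜ : rowAt (insertColumn T p) n ≡ insertAt (rowAt T n) p (num n)
  rowᶜ = rowAt-insertColumn T p n 1≤n (≤-reflexive (sym lenT))

Ψ-fT : ∀ ty n T j p ρ → 1 ≤ j → j ≤ n → length T ≡ n → UnshadedOnlyInRow n j T →
       leftmostOpenT ty n T ≡ just (j , p) →
       Ψ ty n (fT ty n T) ρ ≡ Ψrow ty n j (modifyAt (rowAt T j) p (succJ ty n)) ρ
Ψ-fT ty n T j p ρ 1≤j j≤n lenT shaded lo rewrite fT-at ty n T lo
  with (j ≡ᵇ n) ∧ eqL (entry T j p) (num n) in column
... | false = Ψ-modifyRow ty n j T _ ρ 1≤j j≤n lenT shaded
... | true with refl ← ≡ᵇ⇒≡ j n (proj₁ (Equivalence.to T-∧ (Equivalence.from T-≡ column))) =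
  trans (Ψ-insertColumn-top ty j T₁ p ρ 1≤j (trans (length-modifyRow T j _) lenT)
                            (UnshadedOnlyInRow-modifyRow _ shaded))
        (Ψ-modifyRow ty j j T _ ρ 1≤j j≤n lenT shaded)
  where T₁ = modifyRow T j (λ r → modifyAt r p (succJ ty j))

lemma3p5 : (ty : Ty) (n : ℕ) → 1 ≤ n → (j : ℕ) → 1 ≤ j → j ≤ n →
    (T : Tab) → IsTinf ty n T → UnshadedOnlyInRow n j T →
    (p : ℕ) → leftmostOpenT ty n T ≡ just (j , p) →
    (r : Root) → fKp ty n (Ψ ty n T) r ≡ Ψ ty n (fT ty n T) r
lemma3p5 ty (suc n′) _ j 1≤j j≤n T tinf shaded p lo ρ = begin
  fKp ty n (Ψ ty n T) ρ
    ≡⟨ fKp-Ψrow ty n′ j 1≤j j≤n (opening-step ty n (entry T j p) opens)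
                (modifyAt-replaces (rowAt T j) p (succJ ty n) p<len)
                (Ψ ty n T) (λ ρ′ → Ψ-singleRow ty n j T ρ′ 1≤j j≤n shaded) ρ ⟩
  Ψrow ty n j (modifyAt (rowAt T j) p (succJ ty n)) ρ
    ≡⟨ Ψ-fT ty n T j p ρ 1≤j j≤n (IsTinf.nRows tinf) shaded lo ⟨
  Ψ ty n (fT ty n T) ρ ∎
  where
  open ≡-Reasoning
  n = suc n′
  box = ∈-signature⁻ ty n T (∈-leftmostOpen (signatureT ty n T) lo)
  p<len = proj₁ box
  opens = proj₂ box
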